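{- For every integer $n\ge 0$ there is a bijection $\Lambda_{pd}:\mathcal{PD}^n\to V_{2,5}^n$, where $\mathcal{PD}^n$ is the set of partitions of $n$ with designated summands, and $V_{2,5}^n$ is the set of quintuples $(\lambda^{(1)},\lambda^{(2)},\lambda^{(3)},\lambda^{(4)},\lambda^{(5)})$ of partitions with $\sum_{i=1}^5|\lambda^{(i)}|=n$ such that $\lambda^{(1)},\lambda^{(2)},\lambda^{(3)}$ have only even parts, $\lambda^{(4)}$ is a staircase partition, and $\lambda^{(5)}$ is a partition into distinct parts each divisible by $3$.
   Context: A partition of $n$ is a weakly decreasing finite sequence of positive integers summing to $n$ (the empty partition is the partition of $0$); $|\lambda|$ is the sum of the parts. A partition with designated summands is a partition in which, for each part size occurring, exactly one of the parts of that size is tagged (designated); two such objects are different if the underlying partitions or the positions of the designated parts differ. A staircase partition is a partition of the form $m+(m-1)+\cdots+2+1$ for some $m\ge 0$ (the empty partition for $m=0$). -}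

module Defs where

open import Data.Nat using (ℕ; zero; suc; _+_; _≥_; _>_; _<_; _≡ᵇ_)
open import Data.Nat.Divisibility using (_∣_)
open import Data.Bool using (Bool; true; false; if_then_else_; _∧_)
open import Data.List using (List; []; _∷_; map)
open import Data.Nat.ListAction using (sum)
open import Data.List.Relation.Unary.All using (All)
open import Data.List.Relation.Unary.Linked using (Linked)
open import Data.Product using (Σ; _×_; proj₁; proj₂)
open import Relation.Binary.PropositionalEquality using (_≡_)

IsPartition : List ℕ → Set
IsPartition l = Linked _≥_ l × All (λ k → 0 < k) l

Partition : ℕ → Set
Partition n = Σ (List ℕ) λ l → IsPartition l × sum l ≡ n

-- Partition with designated summands: list of parts, each with a tag
-- (true = designated).  Number of designated parts of size k.
designatedCount : ℕ → List (ℕ × Bool) → ℕ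
designatedCount k [] = 0
designatedCount k ((a Data.Product., b) ∷ xs) =
  (if b ∧ (a ≡ᵇ k) then 1 else 0) + designatedCount k xs

ExactlyOneDesignated : List (ℕ × Bool) → Set
ExactlyOneDesignated xs = All (λ p → designatedCount (proj₁ p) xs ≡ 1) xs

PD : ℕ → Set
PD n = Σ (List (ℕ × Bool)) λ xs →
  IsPartition (map proj₁ xs) × ExactlyOneDesignated xs × sum (map proj₁ xs) ≡ n

staircase : ℕ → List ℕ
staircase zero = []
staircase (suc m) = suc m ∷ staircase m

IsStaircase : List ℕ → Set
IsStaircase l = Σ ℕ λ m → l ≡ staircase m

record V25 (n : ℕ) : Set where
  field
    λ₁ λ₂ λ₃ λ₄ λ₅ : List ℕ
    part₁ : IsPartition λ₁
    part₂ : IsPartition λ₂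
    part₃ : IsPartition λ₃
    part₄ : IsPartition λ₄
    part₅ : IsPartition λ₅
    total : sum λ₁ + sum λ₂ + sum λ₃ + sum λ₄ + sum λ₅ ≡ n
    even₁ : All (2 ∣_) λ₁
    even₂ : All (2 ∣_) λ₂
    even₃ : All (2 ∣_) λ₃
    stair₄ : IsStaircase λ₄
    distinct₅ : Linked _>_ λ₅
    div3₅ : All (3 ∣_) λ₅

-- Group the parts of a partition with designated summands by size. The run of parts equal to k is recorded by
-- the numbers a, b of parts before and after the designated one, so its multiplicity is a + b + 1; such pairs
-- are in bijection with triples (e , x , y) ∈ Bool × ℕ × ℕ with 3e + 2x + y = a + b + 1, which is the identity
-- 1 + q/(1 − q)² = (1 + q³)/((1 − q)(1 − q²)). Over all k, the e's give distinct parts 3k, the x's a partition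
-- into even parts 2k, and the y's the multiplicities of an arbitrary partition μ. By Littlewood's decomposition,
-- μ corresponds to its 2-core, a staircase of size m, together with its 2-quotient (α , β), and
-- |μ| = m(m + 1)/2 + 2(|α| + |β|); doubling α and β gives the remaining two even partitions. The decomposition is
-- read off the boundary word of μ: its letters in even and odd positions are the two runners of the 2-abacus,
-- and counting inversions of the word gives the size identity.

module Submission where

open import Defs
open import Axiom.UniquenessOfIdentityProofs using (module Decidable⇒UIP)
open import Data.Bool using (Bool; true; false; _∧_; if_then_else_)
open import Data.Empty using (⊥-elim)
open import Data.List using (List; []; _∷_; length; replicate; _++_; map; concat; head; takeWhile; dropWhile)
import Data.List.Properties as ListP
open import Data.List.Relation.Unary.All using (All; []; _∷_)
import Data.List.Relation.Unary.All as All
import Data.List.Relation.Unary.All.Properties as AllP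
open import Data.List.Relation.Unary.Linked using (Linked; []; [-]; _∷_)
import Data.List.Relation.Unary.Linked as Linked
open import Data.List.Relation.Unary.Linked.Properties as LinkedP using (Linked⇒All)
open import Data.Maybe using (Maybe; just; nothing) renaming (map to mapMaybe)
import Data.Maybe.Relation.Unary.All as MaybeAll
open import Data.Nat
open import Data.Nat.DivMod using (m*n/n≡m; m/n*n≡m; m/n≤m; /-monoˡ-≤)
open import Data.Nat.Divisibility using (_∣_; divides)
open import Data.Nat.ListAction using (sum)
open import Data.Nat.ListAction.Properties using (sum-++)
open import Data.Nat.Properties
open import Data.Nat.Tactic.RingSolver using (solve-∀)
open import Data.Product using (Σ; _×_; _,_; proj₁; proj₂; map₁)
open import Data.Sum using (_⊎_; inj₁; inj₂)
open import Data.Unit using (⊤; tt)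
open import Data.Vec using (Vec; []; _∷_; toList)
import Data.Vec as Vec
open import Data.Vec.Relation.Unary.All as VecAll using ([]; _∷_)
open import Function.Base using (_∘_; id)
open import Function.Bundles using (_⤖_; _↔_; mk↔ₛ′)
open import Function.Properties.Inverse using (↔⇒⤖; ↔-sym; ↔-trans)
open import Relation.Binary.PropositionalEquality
open import Relation.Nullary using (yes; no; ¬_)
open import Relation.Nullary.Decidable using (dec-true; dec-false)
open import Relation.Unary using (Decidable)

-- Partitions and binary words

IsPartition-tail : ∀ {a l} → IsPartition (a ∷ l) → IsPartition l
IsPartition-tail (lk , _ ∷ ps) = Linked.tail lk , ps

IsPartition-≤head : ∀ {a l} → IsPartition (a ∷ l) → All (_≤ a) (a ∷ l)
IsPartition-≤head (lk , _) = Linked⇒All (λ x≥y y≥z → ≤-trans y≥z x≥y) ≤-refl lk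

IsPartition-∷ : ∀ {a l} → 0 < a → All (_≤ a) l → IsPartition l → IsPartition (a ∷ l)
IsPartition-∷ pos [] _ = [-] , pos ∷ []
IsPartition-∷ pos (h ∷ _) (lk , ps) = h ∷ lk , pos ∷ ps

All≤-weaken : ∀ {k k′ l} → k ≤ k′ → All (_≤ k) l → All (_≤ k′) l
All≤-weaken k≤k′ = All.map (λ x≤k → ≤-trans x≤k k≤k′)

parts≤sum : ∀ l → All (_≤ sum l) l
parts≤sum [] = []
parts≤sum (a ∷ l) = m≤m+n a (sum l) ∷ All≤-weaken (m≤n+m (sum l) a) (parts≤sum l)

length≤sum : ∀ {l} → IsPartition l → length l ≤ sum l
length≤sum {[]} _ = z≤n
length≤sum {a ∷ l} p@(_ , pos ∷ _) = +-mono-≤ pos (length≤sum (IsPartition-tail p))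

ones : List Bool → ℕ
ones [] = 0
ones (true ∷ w) = suc (ones w)
ones (false ∷ w) = ones w

zeros : List Bool → ℕ
zeros [] = 0
zeros (true ∷ w) = zeros w
zeros (false ∷ w) = suc (zeros w)

inversions : List Bool → ℕ
inversions [] = 0
inversions (true ∷ w) = zeros w + inversions w
inversions (false ∷ w) = inversions w

length≡zeros+ones : ∀ w → length w ≡ zeros w + ones w
length≡zeros+ones [] = refl
length≡zeros+ones (true ∷ w) = trans (cong suc (length≡zeros+ones w)) (sym (+-suc (zeros w) (ones w)))
length≡zeros+ones (false ∷ w) = cong suc (length≡zeros+ones w)

ones≡0⇒allFalse : ∀ w → ones w ≡ 0 → w ≡ replicate (zeros w) false
ones≡0⇒allFalse [] _ = refl
ones≡0⇒allFalse (false ∷ w) e = cong (false ∷_) (ones≡0⇒allFalse w e)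

zeros≡0⇒allTrue : ∀ w → zeros w ≡ 0 → w ≡ replicate (ones w) true
zeros≡0⇒allTrue [] _ = refl
zeros≡0⇒allTrue (true ∷ w) e = cong (true ∷_) (zeros≡0⇒allTrue w e)

zeros-replicate-true : ∀ k → zeros (replicate k true) ≡ 0
zeros-replicate-true zero = refl
zeros-replicate-true (suc k) = zeros-replicate-true k

ones-replicate-true : ∀ k → ones (replicate k true) ≡ k
ones-replicate-true zero = refl
ones-replicate-true (suc k) = cong suc (ones-replicate-true k)

zeros-replicate-false : ∀ k → zeros (replicate k false) ≡ k
zeros-replicate-false zero = refl
zeros-replicate-false (suc k) = cong suc (zeros-replicate-false k)

ones-replicate-false : ∀ k → ones (replicate k false) ≡ 0
ones-replicate-false zero = refl
ones-replicate-false (suc k) = ones-replicate-false k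

consNonZero : ℕ → List ℕ → List ℕ
consNonZero zero l = l
consNonZero (suc k) l = suc k ∷ l

-- Reading the word as a lattice path, each 1 (a row) contributes the number of 0s (columns) after it.
wordPartition : List Bool → List ℕ
wordPartition [] = []
wordPartition (false ∷ w) = wordPartition w
wordPartition (true ∷ w) = consNonZero (zeros w) (wordPartition w)

-- The word with K zeros and p ones whose partition is l, provided l fits in a p × K box.
boundary : ℕ → ℕ → List ℕ → List Bool
boundary zero p l = replicate p true
boundary (suc K) zero l = replicate (suc K) false
boundary (suc K) (suc p) [] = false ∷ boundary K (suc p) []
boundary (suc K) (suc p) (a ∷ l) with a ≟ suc K
... | yes _ = true ∷ boundary (suc K) p l
... | no _ = false ∷ boundary K (suc p) (a ∷ l)

FitsIn : ℕ → ℕ → List ℕ → Set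
FitsIn K p l = IsPartition l × length l ≤ p × All (_≤ K) l

zeros-boundary : ∀ K p l → zeros (boundary K p l) ≡ K
zeros-boundary zero p l = zeros-replicate-true p
zeros-boundary (suc K) zero l = zeros-replicate-false (suc K)
zeros-boundary (suc K) (suc p) [] = cong suc (zeros-boundary K (suc p) [])
zeros-boundary (suc K) (suc p) (a ∷ l) with a ≟ suc K
... | yes _ = zeros-boundary (suc K) p l
... | no _ = cong suc (zeros-boundary K (suc p) (a ∷ l))

ones-boundary : ∀ K p l → ones (boundary K p l) ≡ p
ones-boundary zero p l = ones-replicate-true p
ones-boundary (suc K) zero l = ones-replicate-false (suc K)
ones-boundary (suc K) (suc p) [] = ones-boundary K (suc p) []
ones-boundary (suc K) (suc p) (a ∷ l) with a ≟ suc K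
... | yes _ = cong suc (ones-boundary (suc K) p l)
... | no _ = ones-boundary K (suc p) (a ∷ l)

length-boundary : ∀ K p l → length (boundary K p l) ≡ K + p
length-boundary K p l = trans (length≡zeros+ones (boundary K p l))
  (cong₂ _+_ (zeros-boundary K p l) (ones-boundary K p l))

boundary-top : ∀ K p l → boundary (suc K) (suc p) (suc K ∷ l) ≡ true ∷ boundary (suc K) p l
boundary-top K p l with suc K ≟ suc K
... | yes _ = refl
... | no ne = ⊥-elim (ne refl)

boundary-below : ∀ K p l → All (_≤ K) l → boundary (suc K) (suc p) l ≡ false ∷ boundary K (suc p) l
boundary-below K p [] _ = refl
boundary-below K p (a ∷ l) (a≤K ∷ _) with a ≟ suc K
... | yes refl = ⊥-elim (1+n≰n a≤K)
... | no _ = refl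

wordPartition-bounded : ∀ w → All (_≤ zeros w) (wordPartition w)
wordPartition-bounded [] = []
wordPartition-bounded (false ∷ w) = All≤-weaken (n≤1+n _) (wordPartition-bounded w)
wordPartition-bounded (true ∷ w) with zeros w | wordPartition-bounded w
... | zero | bounded = bounded
... | suc _ | bounded = ≤-refl ∷ bounded

wordPartition-isPartition : ∀ w → IsPartition (wordPartition w)
wordPartition-isPartition [] = [] , []
wordPartition-isPartition (false ∷ w) = wordPartition-isPartition w
wordPartition-isPartition (true ∷ w) with zeros w | wordPartition-bounded w
... | zero | _ = wordPartition-isPartition w
... | suc _ | bounded = IsPartition-∷ (s≤s z≤n) bounded (wordPartition-isPartition w)

sum-wordPartition : ∀ w → sum (wordPartition w) ≡ inversions w
sum-wordPartition [] = refl
sum-wordPartition (false ∷ w) = sum-wordPartition w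
sum-wordPartition (true ∷ w) with zeros w
... | zero = sum-wordPartition w
... | suc k = cong (suc k +_) (sum-wordPartition w)

boundary-wordPartition : ∀ w → boundary (zeros w) (ones w) (wordPartition w) ≡ w
boundary-wordPartition [] = refl
boundary-wordPartition (true ∷ w) with zeros w in eq
... | zero = cong (true ∷_) (sym (zeros≡0⇒allTrue w eq))
... | suc k = trans (boundary-top k (ones w) (wordPartition w))
  (cong (true ∷_) (subst (λ K → boundary K (ones w) (wordPartition w) ≡ w) eq (boundary-wordPartition w)))
boundary-wordPartition (false ∷ w) with ones w in eq
... | zero = cong (false ∷_) (sym (ones≡0⇒allFalse w eq))
... | suc p = trans (boundary-below (zeros w) p (wordPartition w) (wordPartition-bounded w))
  (cong (false ∷_) (subst (λ q → boundary (zeros w) q (wordPartition w) ≡ w) eq (boundary-wordPartition w)))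

wordPartition-allTrue : ∀ p → wordPartition (replicate p true) ≡ []
wordPartition-allTrue zero = refl
wordPartition-allTrue (suc p) rewrite zeros-replicate-true p = wordPartition-allTrue p

wordPartition-allFalse : ∀ p → wordPartition (replicate p false) ≡ []
wordPartition-allFalse zero = refl
wordPartition-allFalse (suc p) = wordPartition-allFalse p

wordPartition-boundary : ∀ K p l → FitsIn K p l → wordPartition (boundary K p l) ≡ l
wordPartition-boundary zero p [] _ = wordPartition-allTrue p
wordPartition-boundary zero p (a ∷ l) ((_ , pos ∷ _) , _ , a≤0 ∷ _) = ⊥-elim (<⇒≱ pos a≤0)
wordPartition-boundary (suc K) zero [] _ = wordPartition-allFalse (suc K)
wordPartition-boundary (suc K) (suc p) [] _ = wordPartition-boundary K (suc p) [] (([] , []) , z≤n , [])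
wordPartition-boundary (suc K) (suc p) (a ∷ l) (pl , s≤s len , a≤1+K ∷ l≤1+K) with a ≟ suc K
... | yes refl rewrite zeros-boundary (suc K) p l =
  cong (suc K ∷_) (wordPartition-boundary (suc K) p l (IsPartition-tail pl , len , l≤1+K))
... | no a≢1+K = wordPartition-boundary K (suc p) (a ∷ l)
  (pl , s≤s len , All≤-weaken a≤K (IsPartition-≤head pl))
  where a≤K = ≤-pred (≤∧≢⇒< a≤1+K a≢1+K)

sum≤⇒FitsIn : ∀ {K p l} → IsPartition l → sum l ≤ K → sum l ≤ p → FitsIn K p l
sum≤⇒FitsIn {l = l} pl ≤K ≤p = pl , ≤-trans (length≤sum pl) ≤p , All≤-weaken ≤K (parts≤sum l)

-- The 2-quotient

module _ {A : Set} where

  deinterleave : List A → List A × List A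
  deinterleave [] = [] , []
  deinterleave (a ∷ w) = (a ∷ proj₂ (deinterleave w)) , proj₁ (deinterleave w)

  interleave : List A → List A → List A
  interleave [] bs = bs
  interleave (a ∷ as) bs = a ∷ interleave bs as

  interleave-deinterleave : ∀ w → interleave (proj₁ (deinterleave w)) (proj₂ (deinterleave w)) ≡ w
  interleave-deinterleave [] = refl
  interleave-deinterleave (a ∷ w) = cong (a ∷_) (interleave-deinterleave w)

  deinterleave-interleave : ∀ as bs → length bs ≤ length as → length as ≤ suc (length bs) →
                            deinterleave (interleave as bs) ≡ (as , bs)
  deinterleave-interleave [] [] _ _ = refl
  deinterleave-interleave (a ∷ as) bs bs≤1+as (s≤s as≤bs)
    rewrite deinterleave-interleave bs as as≤bs bs≤1+as = refl

  length-interleave : ∀ as bs → length (interleave as bs) ≡ length as + length bs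
  length-interleave [] bs = refl
  length-interleave (a ∷ as) bs = cong suc (trans (length-interleave bs as) (+-comm (length bs) (length as)))

  length-deinterleave : ∀ k w → length w ≡ k + k →
                        length (proj₁ (deinterleave w)) ≡ k × length (proj₂ (deinterleave w)) ≡ k
  length-deinterleave zero [] _ = refl , refl
  length-deinterleave (suc k) (a ∷ []) e rewrite +-suc k k with () ← suc-injective e
  length-deinterleave (suc k) (a ∷ b ∷ w) e
    with length-deinterleave k w (suc-injective (trans (suc-injective e) (+-suc k k)))
  ... | e₀ , e₁ = cong suc e₀ , cong suc e₁

ones-interleave : ∀ as bs → ones (interleave as bs) ≡ ones as + ones bs
ones-interleave [] bs = refl
ones-interleave (true ∷ as) bs = cong suc (trans (ones-interleave bs as) (+-comm (ones bs) (ones as)))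
ones-interleave (false ∷ as) bs = trans (ones-interleave bs as) (+-comm (ones bs) (ones as))

zeros-interleave : ∀ as bs → zeros (interleave as bs) ≡ zeros as + zeros bs
zeros-interleave [] bs = refl
zeros-interleave (false ∷ as) bs = cong suc (trans (zeros-interleave bs as) (+-comm (zeros bs) (zeros as)))
zeros-interleave (true ∷ as) bs = trans (zeros-interleave bs as) (+-comm (zeros bs) (zeros as))

choose₂ : ℕ → ℕ
choose₂ zero = 0
choose₂ (suc k) = choose₂ k + k

-- Unlike inversions, this statistic splits additively over the two runners of an interleaving.
suffixLengths : List Bool → ℕ
suffixLengths [] = 0
suffixLengths (true ∷ w) = length w + suffixLengths w
suffixLengths (false ∷ w) = suffixLengths w

suffixLengths≡inversions+choose₂ : ∀ w → suffixLengths w ≡ inversions w + choose₂ (ones w)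
suffixLengths≡inversions+choose₂ [] = refl
suffixLengths≡inversions+choose₂ (false ∷ w) = suffixLengths≡inversions+choose₂ w
suffixLengths≡inversions+choose₂ (true ∷ w)
  rewrite suffixLengths≡inversions+choose₂ w | length≡zeros+ones w =
  rearrange (zeros w) (ones w) (inversions w) (choose₂ (ones w))
  where rearrange : ∀ z o i c → z + o + (i + c) ≡ z + i + (c + o)
        rearrange = solve-∀

mutual
  suffixLengths-interleave : ∀ as bs → length as ≡ length bs →
    suffixLengths (interleave as bs) ≡ 2 * suffixLengths as + ones as + 2 * suffixLengths bs
  suffixLengths-interleave [] [] _ = refl
  suffixLengths-interleave (true ∷ as) bs e
    rewrite length-interleave bs as | suffixLengths-interleave′ bs as (sym e) | sym e =
    rearrange (length as) (suffixLengths bs) (suffixLengths as) (ones as)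
    where rearrange : ∀ l x y o → suc (l + l) + (2 * x + 2 * y + o) ≡ 2 * (l + y) + suc o + 2 * x
          rearrange = solve-∀
  suffixLengths-interleave (false ∷ as) bs e
    rewrite suffixLengths-interleave′ bs as (sym e) =
    rearrange (suffixLengths bs) (suffixLengths as) (ones as)
    where rearrange : ∀ x y o → 2 * x + 2 * y + o ≡ 2 * y + o + 2 * x
          rearrange = solve-∀

  suffixLengths-interleave′ : ∀ as bs → length as ≡ suc (length bs) →
    suffixLengths (interleave as bs) ≡ 2 * suffixLengths as + 2 * suffixLengths bs + ones bs
  suffixLengths-interleave′ (true ∷ as) bs e
    rewrite length-interleave bs as | suffixLengths-interleave bs as (sym (suc-injective e)) | suc-injective e =
    rearrange (length bs) (suffixLengths bs) (suffixLengths as) (ones bs)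
    where rearrange : ∀ l x y o → l + l + (2 * x + o + 2 * y) ≡ 2 * (l + y) + 2 * x + o
          rearrange = solve-∀
  suffixLengths-interleave′ (false ∷ as) bs e
    rewrite suffixLengths-interleave bs as (sym (suc-injective e)) =
    rearrange (suffixLengths bs) (suffixLengths as) (ones bs)
    where rearrange : ∀ x y o → 2 * x + o + 2 * y ≡ 2 * y + 2 * x + o
          rearrange = solve-∀

-- The 2-core of a partition whose runners carry p and r ones is the staircase of this size: the charge
-- p − r ∈ ℤ folded onto ℕ.
coreSize : ℕ → ℕ → ℕ
coreSize (suc p) (suc r) = coreSize p r
coreSize p zero = p
coreSize zero (suc r) = r

coreSize-cases : ∀ p r → p ≡ r + coreSize p r ⊎ r ≡ p + suc (coreSize p r)
coreSize-cases (suc p) (suc r) with coreSize-cases p r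
... | inj₁ e = inj₁ (cong suc e)
... | inj₂ e = inj₂ (cong suc e)
coreSize-cases zero zero = inj₁ refl
coreSize-cases (suc p) zero = inj₁ refl
coreSize-cases zero (suc r) = inj₂ refl

coreSize-+ˡ : ∀ r m → coreSize (r + m) r ≡ m
coreSize-+ˡ zero zero = refl
coreSize-+ˡ zero (suc m) = refl
coreSize-+ˡ (suc r) m = coreSize-+ˡ r m

coreSize-+ʳ : ∀ p m → coreSize p (p + suc m) ≡ m
coreSize-+ʳ zero m = refl
coreSize-+ʳ (suc p) m = coreSize-+ʳ p m

choose₂-coreSize : ∀ p r → 2 * choose₂ p + p + 2 * choose₂ r ≡ choose₂ (p + r) + choose₂ (suc (coreSize p r))
choose₂-coreSize zero zero = refl
choose₂-coreSize (suc p) zero rewrite +-identityʳ p = rearrange (choose₂ p) p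
  where rearrange : ∀ c p → 2 * (c + p) + suc p + 0 ≡ c + p + (c + p + suc p)
        rearrange = solve-∀
choose₂-coreSize zero (suc r) = rearrange (choose₂ r) r
  where rearrange : ∀ c r → 0 + 2 * (c + r) ≡ c + r + (c + r)
        rearrange = solve-∀
choose₂-coreSize (suc p) (suc r) rewrite +-suc p r = begin
  2 * (choose₂ p + p) + suc p + 2 * (choose₂ r + r)
    ≡⟨ expand (choose₂ p) p (choose₂ r) r ⟩
  2 * choose₂ p + p + 2 * choose₂ r + 2 * p + 2 * r + 1
    ≡⟨ cong (λ x → x + 2 * p + 2 * r + 1) (choose₂-coreSize p r) ⟩
  choose₂ (p + r) + choose₂ (suc m) + 2 * p + 2 * r + 1
    ≡⟨ collect (choose₂ (p + r)) p r (choose₂ m + m) ⟩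
  choose₂ (p + r) + (p + r) + suc (p + r) + choose₂ (suc m) ∎
  where
  open ≡-Reasoning
  m = coreSize p r
  expand : ∀ c p d r → 2 * (c + p) + suc p + 2 * (d + r) ≡ 2 * c + p + 2 * d + 2 * p + 2 * r + 1
  expand = solve-∀
  collect : ∀ c p r t → c + t + 2 * p + 2 * r + 1 ≡ c + (p + r) + suc (p + r) + t
  collect = solve-∀

inversions-interleave : ∀ w₀ w₁ → length w₀ ≡ length w₁ →
  inversions (interleave w₀ w₁) ≡
  2 * (inversions w₀ + inversions w₁) + choose₂ (suc (coreSize (ones w₀) (ones w₁)))
inversions-interleave w₀ w₁ e = +-cancelʳ-≡ (choose₂ (o₀ + o₁)) _ _ (begin
  inversions w + choose₂ (o₀ + o₁)     ≡⟨ cong (λ k → inversions w + choose₂ k) (sym (ones-interleave w₀ w₁)) ⟩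
  inversions w + choose₂ (ones w)      ≡⟨ sym (suffixLengths≡inversions+choose₂ w) ⟩
  suffixLengths w                      ≡⟨ suffixLengths-interleave w₀ w₁ e ⟩
  2 * suffixLengths w₀ + o₀ + 2 * suffixLengths w₁
    ≡⟨ cong₂ (λ a b → 2 * a + o₀ + 2 * b) (suffixLengths≡inversions+choose₂ w₀) (suffixLengths≡inversions+choose₂ w₁) ⟩
  2 * (i₀ + choose₂ o₀) + o₀ + 2 * (i₁ + choose₂ o₁)
    ≡⟨ separate i₀ i₁ (choose₂ o₀) (choose₂ o₁) o₀ ⟩
  2 * (i₀ + i₁) + (2 * choose₂ o₀ + o₀ + 2 * choose₂ o₁)
    ≡⟨ cong (2 * (i₀ + i₁) +_) (choose₂-coreSize o₀ o₁) ⟩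
  2 * (i₀ + i₁) + (choose₂ (o₀ + o₁) + core)
    ≡⟨ swap (2 * (i₀ + i₁)) (choose₂ (o₀ + o₁)) core ⟩
  2 * (i₀ + i₁) + core + choose₂ (o₀ + o₁) ∎)
  where
  open ≡-Reasoning
  w = interleave w₀ w₁
  o₀ = ones w₀
  o₁ = ones w₁
  i₀ = inversions w₀
  i₁ = inversions w₁
  core = choose₂ (suc (coreSize o₀ o₁))
  separate : ∀ a b x y o → 2 * (a + x) + o + 2 * (b + y) ≡ 2 * (a + b) + (2 * x + o + 2 * y)
  separate = solve-∀
  swap : ∀ a c t → a + (c + t) ≡ a + t + c
  swap = solve-∀

bit : Bool → ℕ
bit false = 0
bit true = 1

halve : ℕ → ℕ × Bool
halve zero = 0 , false
halve (suc n) with halve n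
... | q , false = q , true
... | q , true = suc q , false

halve-spec : ∀ n → let (q , b) = halve n in n ≡ 2 * q + bit b
halve-spec zero = refl
halve-spec (suc n) with halve n | halve-spec n
... | q , false | e = trans (cong suc e) (rearrange q)
  where rearrange : ∀ q → suc (2 * q + 0) ≡ 2 * q + 1
        rearrange = solve-∀
... | q , true | e = trans (cong suc e) (rearrange q)
  where rearrange : ∀ q → suc (2 * q + 1) ≡ 2 * suc q + 0
        rearrange = solve-∀

halve-double : ∀ q b → halve (2 * q + bit b) ≡ (q , b)
halve-double zero false = refl
halve-double zero true = refl
halve-double (suc q) b rewrite +-suc q (q + 0) | halve-double q b with b
... | false = refl
... | true = refl

double+bit-injective : ∀ {q b q′ b′} → 2 * q + bit b ≡ 2 * q′ + bit b′ → (q , b) ≡ (q′ , b′)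
double+bit-injective {q} {b} {q′} {b′} e =
  trans (sym (halve-double q b)) (trans (cong halve e) (halve-double q′ b′))

-- The numbers of ones (p , r) on the runners of the partition with 2-core of size m and 2-quotient of size s;
-- the parity of choose₂ m decides which runner carries the charge.
runnerOnes : ℕ → ℕ → ℕ × ℕ
runnerOnes m s with halve (choose₂ m)
... | q , false = s + q + m , s + q
... | q , true = s + q , s + q + suc m

runnerOnes-halves : ∀ {m s r q} b b′ → choose₂ m ≡ 2 * q + bit b′ →
                    2 * r + bit b + m ≡ 2 * s + choose₂ (suc m) → (r , b) ≡ (s + q , b′)
runnerOnes-halves {m} {s} {r} {q} b b′ spec h = double+bit-injective (+-cancelʳ-≡ m _ _ (begin
  2 * r + bit b + m              ≡⟨ h ⟩
  2 * s + (choose₂ m + m)        ≡⟨ cong (λ c → 2 * s + (c + m)) spec ⟩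
  2 * s + (2 * q + bit b′ + m)   ≡⟨ rearrange s q (bit b′) m ⟩
  2 * (s + q) + bit b′ + m       ∎))
  where
  open ≡-Reasoning
  rearrange : ∀ s q t m → 2 * s + (2 * q + t + m) ≡ 2 * (s + q) + t + m
  rearrange = solve-∀

runnerOnes-≥ : ∀ r m s → r + m + r ≡ 2 * s + choose₂ (suc m) → runnerOnes m s ≡ (r + m , r)
runnerOnes-≥ r m s h with halve (choose₂ m) | halve-spec (choose₂ m)
... | q , b | spec with runnerOnes-halves {m} {s} {r} {q} false b spec (trans (rearrange r m) h)
  where rearrange : ∀ r m → 2 * r + 0 + m ≡ r + m + r
        rearrange = solve-∀
... | refl = refl

runnerOnes-< : ∀ p m s → p + (p + suc m) ≡ 2 * s + choose₂ (suc m) → runnerOnes m s ≡ (p , p + suc m)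
runnerOnes-< p m s h with halve (choose₂ m) | halve-spec (choose₂ m)
... | q , b | spec with runnerOnes-halves {m} {s} {p} {q} true b spec (trans (rearrange p m) h)
  where rearrange : ∀ p m → 2 * p + 1 + m ≡ p + (p + suc m)
        rearrange = solve-∀
... | refl = refl

runnerOnes-coreSize : ∀ p r s → p + r ≡ 2 * s + choose₂ (suc (coreSize p r)) → runnerOnes (coreSize p r) s ≡ (p , r)
runnerOnes-coreSize p r s h with coreSize p r | coreSize-cases p r
... | m | inj₁ refl = runnerOnes-≥ r m s h
... | m | inj₂ refl = runnerOnes-< p m s h

runnerOnes-spec : ∀ m s → let (p , r) = runnerOnes m s in
  coreSize p r ≡ m × p + r ≡ 2 * s + choose₂ (suc m) × s ≤ p × s ≤ r
runnerOnes-spec m s with halve (choose₂ m) | halve-spec (choose₂ m)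
... | q , false | e rewrite e =
  coreSize-+ˡ (s + q) m , rearrange s q m , ≤-trans (m≤m+n s q) (m≤m+n (s + q) m) , m≤m+n s q
  where rearrange : ∀ s q m → s + q + m + (s + q) ≡ 2 * s + (2 * q + 0 + m)
        rearrange = solve-∀
... | q , true | e rewrite e =
  coreSize-+ʳ (s + q) m , rearrange s q m , m≤m+n s q , ≤-trans (m≤m+n s q) (m≤m+n (s + q) (suc m))
  where rearrange : ∀ s q m → s + q + (s + q + suc m) ≡ 2 * s + (2 * q + 1 + m)
        rearrange = solve-∀

boundary-wordPartition-square : ∀ w {K} → zeros w ≡ K → ones w ≡ K → boundary K K (wordPartition w) ≡ w
boundary-wordPartition-square w refl o≡z =
  subst (λ k → boundary (zeros w) k (wordPartition w) ≡ w) o≡z (boundary-wordPartition w)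

runnersPartition : ℕ → ℕ → List ℕ → List ℕ → List ℕ
runnersPartition p r α β = wordPartition (interleave (boundary r p α) (boundary p r β))

fromTwoQuotient : ℕ → List ℕ → List ℕ → List ℕ
fromTwoQuotient m α β = let (p , r) = runnerOnes m (sum α + sum β) in runnersPartition p r α β

quotientOfRunners : List Bool × List Bool → ℕ × List ℕ × List ℕ
quotientOfRunners (w₀ , w₁) = coreSize (ones w₀) (ones w₁) , wordPartition w₀ , wordPartition w₁

twoQuotient : List ℕ → ℕ × List ℕ × List ℕ
twoQuotient μ = quotientOfRunners (deinterleave (boundary (sum μ) (sum μ) μ))

module _ {p r m α β} (α-fits : FitsIn r p α) (β-fits : FitsIn p r β) (core≡ : coreSize p r ≡ m)
         (size : p + r ≡ 2 * (sum α + sum β) + choose₂ (suc m)) where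
  private
    w₀ = boundary r p α
    w₁ = boundary p r β
    w = interleave w₀ w₁

    α≡ : wordPartition w₀ ≡ α
    α≡ = wordPartition-boundary r p α α-fits

    β≡ : wordPartition w₁ ≡ β
    β≡ = wordPartition-boundary p r β β-fits

    core≡m : coreSize (ones w₀) (ones w₁) ≡ m
    core≡m = trans (cong₂ coreSize (ones-boundary r p α) (ones-boundary p r β)) core≡

    same-length : length w₀ ≡ length w₁
    same-length = trans (length-boundary r p α) (trans (+-comm r p) (sym (length-boundary p r β)))

  sum-runnersPartition : sum (runnersPartition p r α β) ≡ p + r
  sum-runnersPartition = begin
    sum (wordPartition w)   ≡⟨ sum-wordPartition w ⟩
    inversions w            ≡⟨ inversions-interleave w₀ w₁ same-length ⟩
    2 * (inversions w₀ + inversions w₁) + choose₂ (suc (coreSize (ones w₀) (ones w₁)))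
      ≡⟨ cong₂ (λ a b → 2 * a + choose₂ (suc b))
           (cong₂ _+_ (trans (sym (sum-wordPartition w₀)) (cong sum α≡)) (trans (sym (sum-wordPartition w₁)) (cong sum β≡)))
           core≡m ⟩
    2 * (sum α + sum β) + choose₂ (suc m) ≡⟨ size ⟨
    p + r ∎
    where open ≡-Reasoning

  twoQuotient-runnersPartition : twoQuotient (runnersPartition p r α β) ≡ (m , α , β)
  twoQuotient-runnersPartition = begin
    twoQuotient (wordPartition w)
      ≡⟨ cong (quotientOfRunners ∘ deinterleave) (boundary-wordPartition-square w zeros≡ ones≡) ⟩
    quotientOfRunners (deinterleave w)
      ≡⟨ cong quotientOfRunners (deinterleave-interleave w₀ w₁ (≤-reflexive (sym same-length))
                                                            (m≤n⇒m≤1+n (≤-reflexive same-length))) ⟩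
    quotientOfRunners (w₀ , w₁)
      ≡⟨ cong₂ _,_ core≡m (cong₂ _,_ α≡ β≡) ⟩
    m , α , β ∎
    where
    open ≡-Reasoning
    zeros≡ : zeros w ≡ sum (wordPartition w)
    zeros≡ = begin
      zeros w                        ≡⟨ zeros-interleave w₀ w₁ ⟩
      zeros w₀ + zeros w₁            ≡⟨ cong₂ _+_ (zeros-boundary r p α) (zeros-boundary p r β) ⟩
      r + p                          ≡⟨ +-comm r p ⟩
      p + r                          ≡⟨ sum-runnersPartition ⟨
      sum (wordPartition w)          ∎
    ones≡ : ones w ≡ sum (wordPartition w)
    ones≡ = begin
      ones w                         ≡⟨ ones-interleave w₀ w₁ ⟩
      ones w₀ + ones w₁              ≡⟨ cong₂ _+_ (ones-boundary r p α) (ones-boundary p r β) ⟩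
      p + r                          ≡⟨ sum-runnersPartition ⟨
      sum (wordPartition w)          ∎

module _ (μ : List ℕ) (pμ : IsPartition μ) where
  private
    K = sum μ
    w = boundary K K μ
    w₀ = proj₁ (deinterleave w)
    w₁ = proj₂ (deinterleave w)
    m = coreSize (ones w₀) (ones w₁)

    lengths : length w₀ ≡ K × length w₁ ≡ K
    lengths = length-deinterleave K w (length-boundary K K μ)

    μ≡ : wordPartition w ≡ μ
    μ≡ = wordPartition-boundary K K μ (sum≤⇒FitsIn pμ ≤-refl ≤-refl)

    ones≡ : ones w₀ + ones w₁ ≡ K
    ones≡ = trans (sym (ones-interleave w₀ w₁)) (trans (cong ones (interleave-deinterleave w)) (ones-boundary K K μ))

  twoQuotient-size : let (m , α , β) = twoQuotient μ in sum μ ≡ 2 * (sum α + sum β) + choose₂ (suc m)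
  twoQuotient-size = begin
    sum μ                 ≡⟨ cong sum (sym μ≡) ⟩
    sum (wordPartition w) ≡⟨ sum-wordPartition w ⟩
    inversions w          ≡⟨ cong inversions (sym (interleave-deinterleave w)) ⟩
    inversions (interleave w₀ w₁)
      ≡⟨ inversions-interleave w₀ w₁ (trans (proj₁ lengths) (sym (proj₂ lengths))) ⟩
    2 * (inversions w₀ + inversions w₁) + choose₂ (suc m)
      ≡⟨ cong (λ x → 2 * x + choose₂ (suc m)) (sym (cong₂ _+_ (sum-wordPartition w₀) (sum-wordPartition w₁))) ⟩
    2 * (sum (wordPartition w₀) + sum (wordPartition w₁)) + choose₂ (suc m) ∎
    where open ≡-Reasoning

  fromTwoQuotient-twoQuotient : let (m , α , β) = twoQuotient μ in fromTwoQuotient m α β ≡ μ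
  fromTwoQuotient-twoQuotient = begin
    fromTwoQuotient m α β
      ≡⟨ cong (λ (x : ℕ × ℕ) → runnersPartition (proj₁ x) (proj₂ x) α β)
              (runnerOnes-coreSize p r _ (trans ones≡ twoQuotient-size)) ⟩
    wordPartition (interleave (boundary r p α) (boundary p r β))
      ≡⟨ cong₂ (λ x y → wordPartition (interleave x y))
               (trans (cong (λ k → boundary k p α) (sym zeros₀)) (boundary-wordPartition w₀))
               (trans (cong (λ k → boundary k r β) (sym zeros₁)) (boundary-wordPartition w₁)) ⟩
    wordPartition (interleave w₀ w₁)   ≡⟨ cong wordPartition (interleave-deinterleave w) ⟩
    wordPartition w                    ≡⟨ μ≡ ⟩
    μ ∎
    where
    open ≡-Reasoning
    p = ones w₀
    r = ones w₁
    α = wordPartition w₀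
    β = wordPartition w₁
    zeros₀ : zeros w₀ ≡ r
    zeros₀ = +-cancelʳ-≡ p _ _
      (trans (sym (length≡zeros+ones w₀)) (trans (proj₁ lengths) (trans (sym ones≡) (+-comm p r))))
    zeros₁ : zeros w₁ ≡ p
    zeros₁ = +-cancelʳ-≡ r _ _ (trans (sym (length≡zeros+ones w₁)) (trans (proj₂ lengths) (sym ones≡)))

twoQuotient-isPartition : ∀ μ → let (_ , α , β) = twoQuotient μ in IsPartition α × IsPartition β
twoQuotient-isPartition μ = wordPartition-isPartition (proj₁ runners) , wordPartition-isPartition (proj₂ runners)
  where runners = deinterleave (boundary (sum μ) (sum μ) μ)

fromTwoQuotient-isPartition : ∀ m α β → IsPartition (fromTwoQuotient m α β)
fromTwoQuotient-isPartition m α β =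
  wordPartition-isPartition (interleave (boundary (proj₂ pr) (proj₁ pr) α) (boundary (proj₁ pr) (proj₂ pr) β))
  where pr = runnerOnes m (sum α + sum β)

twoQuotient-fromTwoQuotient : ∀ m {α β} → IsPartition α → IsPartition β →
                              twoQuotient (fromTwoQuotient m α β) ≡ (m , α , β)
twoQuotient-fromTwoQuotient m {α} {β} pα pβ =
  let core≡ , size , s≤p , s≤r = runnerOnes-spec m (sum α + sum β) in
  twoQuotient-runnersPartition (sum≤⇒FitsIn pα (≤-trans α≤s s≤r) (≤-trans α≤s s≤p))
                               (sum≤⇒FitsIn pβ (≤-trans β≤s s≤p) (≤-trans β≤s s≤r)) core≡ size
  where
  α≤s = m≤m+n (sum α) (sum β)
  β≤s = m≤n+m (sum β) (sum α)

fromTwoQuotient-size : ∀ m {α β} → IsPartition α → IsPartition β →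
                       sum (fromTwoQuotient m α β) ≡ 2 * (sum α + sum β) + choose₂ (suc m)
fromTwoQuotient-size m {α} {β} pα pβ =
  trans (twoQuotient-size (fromTwoQuotient m α β) (fromTwoQuotient-isPartition m α β))
        (cong (λ (q : ℕ × List ℕ × List ℕ) → let (m , α , β) = q in 2 * (sum α + sum β) + choose₂ (suc m))
              (twoQuotient-fromTwoQuotient m pα pβ))

-- Runs of equal parts

-- Entry i of a vector of length K describes the parts of size K − i.
weightedSum : ∀ {X : Set} → (X → ℕ) → ∀ {K} → Vec X K → ℕ
weightedSum f [] = 0
weightedSum f {suc K} (x ∷ v) = f x * suc K + weightedSum f v

module _ {A : Set} {P : A → Set} (P? : Decidable P) where

  takeWhile-++ : ∀ {r rest} → All P r → All (¬_ ∘ P) rest → takeWhile P? (r ++ rest) ≡ r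
  takeWhile-++ [] [] = refl
  takeWhile-++ {rest = b ∷ _} [] (¬Pb ∷ _) with P? b
  ... | yes Pb = ⊥-elim (¬Pb Pb)
  ... | no _ = refl
  takeWhile-++ {a ∷ _} (Pa ∷ r-P) rest-¬P with P? a
  ... | yes _ = cong (a ∷_) (takeWhile-++ r-P rest-¬P)
  ... | no ¬Pa = ⊥-elim (¬Pa Pa)

  dropWhile-++ : ∀ {r rest} → All P r → All (¬_ ∘ P) rest → dropWhile P? (r ++ rest) ≡ rest
  dropWhile-++ [] [] = refl
  dropWhile-++ {rest = b ∷ _} [] (¬Pb ∷ _) with P? b
  ... | yes Pb = ⊥-elim (¬Pb Pb)
  ... | no _ = refl
  dropWhile-++ {a ∷ _} (Pa ∷ r-P) rest-¬P with P? a
  ... | yes _ = dropWhile-++ r-P rest-¬P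
  ... | no ¬Pa = ⊥-elim (¬Pa Pa)

IsPartition-++⁻ʳ : ∀ r {l} → IsPartition (r ++ l) → IsPartition l
IsPartition-++⁻ʳ [] p = p
IsPartition-++⁻ʳ (a ∷ r) p = IsPartition-++⁻ʳ r (IsPartition-tail p)

module GroupBySize {A : Set} (size : A → ℕ) where

  HasSize : ℕ → A → Set
  HasSize s a = size a ≡ s

  hasSize? : ∀ s → Decidable (HasSize s)
  hasSize? s a = size a ≟ s

  runs : (K : ℕ) → List A → Vec (List A) K
  runs zero l = []
  runs (suc K) l = takeWhile (hasSize? (suc K)) l ∷ runs K (dropWhile (hasSize? (suc K)) l)

  concatRuns : ∀ {K} → Vec (List A) K → List A
  concatRuns rs = concat (toList rs)

  AreRuns : ∀ {K} → Vec (List A) K → Set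
  AreRuns [] = ⊤
  AreRuns {suc K} (r ∷ rs) = All (HasSize (suc K)) r × AreRuns rs

  runs-AreRuns : ∀ K l → AreRuns (runs K l)
  runs-AreRuns zero l = tt
  runs-AreRuns (suc K) l = AllP.all-takeWhile (hasSize? (suc K)) l , runs-AreRuns K _

  sizes-≤head : ∀ {a l} → IsPartition (map size (a ∷ l)) → All (λ b → size b ≤ size a) (a ∷ l)
  sizes-≤head p = AllP.map⁻ (IsPartition-≤head p)

  head≢⇒All< : ∀ {s l} → IsPartition (map size l) → All (λ a → size a ≤ s) l →
               MaybeAll.All (λ a → ¬ HasSize s a) (head l) → All (λ a → size a < s) l
  head≢⇒All< {l = []} _ _ _ = []
  head≢⇒All< {l = a ∷ l} p (a≤s ∷ _) (MaybeAll.just a≢s) =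
    All.map (λ b≤a → ≤-<-trans b≤a (≤∧≢⇒< a≤s a≢s)) (sizes-≤head p)

  dropWhile-hasSize : ∀ s l → IsPartition (map size l) → All (λ a → size a ≤ s) l →
    IsPartition (map size (dropWhile (hasSize? s) l)) × All (λ a → size a < s) (dropWhile (hasSize? s) l)
  dropWhile-hasSize s l p l≤s = rest-p , head≢⇒All< rest-p rest≤s (AllP.all-head-dropWhile (hasSize? s) l)
    where
    run = takeWhile (hasSize? s) l
    rest = dropWhile (hasSize? s) l
    split : run ++ rest ≡ l
    split = ListP.takeWhile++dropWhile (hasSize? s) l
    rest-p : IsPartition (map size rest)
    rest-p = IsPartition-++⁻ʳ (map size run)
      (subst IsPartition (trans (sym (cong (map size) split)) (ListP.map-++ size run rest)) p)
    rest≤s : All (λ a → size a ≤ s) rest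
    rest≤s = AllP.++⁻ʳ run (subst (All _) (sym split) l≤s)

  concat-runs : ∀ K l → IsPartition (map size l) → All (λ a → size a ≤ K) l → concatRuns (runs K l) ≡ l
  concat-runs zero [] _ _ = refl
  concat-runs zero (a ∷ l) (_ , pos ∷ _) (a≤0 ∷ _) = ⊥-elim (<⇒≱ pos a≤0)
  concat-runs (suc K) l p l≤K with dropWhile-hasSize (suc K) l p l≤K
  ... | p′ , l′<K = trans (cong (takeWhile (hasSize? (suc K)) l ++_) (concat-runs K _ p′ (All.map ≤-pred l′<K)))
                          (ListP.takeWhile++dropWhile (hasSize? (suc K)) l)

  concatRuns-bounded : ∀ {K} (rs : Vec (List A) K) → AreRuns rs → All (λ a → size a ≤ K) (concatRuns rs)
  concatRuns-bounded [] _ = []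
  concatRuns-bounded {suc K} (r ∷ rs) (r-run , rs-runs) =
    AllP.++⁺ (All.map ≤-reflexive r-run) (All.map m≤n⇒m≤1+n (concatRuns-bounded rs rs-runs))

  runs-concat : ∀ {K} (rs : Vec (List A) K) → AreRuns rs → runs K (concatRuns rs) ≡ rs
  runs-concat [] _ = refl
  runs-concat {suc K} (r ∷ rs) (r-run , rs-runs) = cong₂ _∷_ (takeWhile-++ (hasSize? (suc K)) r-run rest≢)
    (trans (cong (runs K) (dropWhile-++ (hasSize? (suc K)) r-run rest≢)) (runs-concat rs rs-runs))
    where rest≢ = All.map (λ a≤K a≡1+K → 1+n≰n (subst (_≤ K) a≡1+K a≤K)) (concatRuns-bounded rs rs-runs)

  concatRuns-isPartition : ∀ {K} (rs : Vec (List A) K) → AreRuns rs → IsPartition (map size (concatRuns rs))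
  concatRuns-isPartition [] _ = [] , []
  concatRuns-isPartition {suc K} (r ∷ rs) (r-run , rs-runs) = prepend r r-run
    where
    rest≤ = All.map m≤n⇒m≤1+n (concatRuns-bounded rs rs-runs)
    prepend : ∀ r → All (HasSize (suc K)) r → IsPartition (map size (r ++ concatRuns rs))
    prepend [] _ = concatRuns-isPartition rs rs-runs
    prepend (a ∷ r) (a≡ ∷ r-run) rewrite a≡ = IsPartition-∷ (s≤s z≤n)
      (AllP.map⁺ (AllP.++⁺ (All.map ≤-reflexive r-run) rest≤)) (prepend r r-run)

  sum-concatRuns : ∀ {K} (rs : Vec (List A) K) → AreRuns rs →
                   sum (map size (concatRuns rs)) ≡ weightedSum length rs
  sum-concatRuns [] _ = refl
  sum-concatRuns {suc K} (r ∷ rs) (r-run , rs-runs) = begin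
    sum (map size (r ++ concatRuns rs))              ≡⟨ cong sum (ListP.map-++ size r (concatRuns rs)) ⟩
    sum (map size r ++ map size (concatRuns rs))     ≡⟨ sum-++ (map size r) _ ⟩
    sum (map size r) + sum (map size (concatRuns rs)) ≡⟨ cong₂ _+_ (sum-run r r-run) (sum-concatRuns rs rs-runs) ⟩
    length r * suc K + weightedSum length rs ∎
    where
    open ≡-Reasoning
    sum-run : ∀ r → All (HasSize (suc K)) r → sum (map size r) ≡ length r * suc K
    sum-run [] [] = refl
    sum-run (a ∷ r) (a≡ ∷ r-run) = cong₂ _+_ a≡ (sum-run r r-run)

module Parts = GroupBySize {ℕ} id

replicates : ∀ {K} → Vec ℕ K → Vec (List ℕ) K
replicates [] = []
replicates {suc K} (c ∷ v) = replicate c (suc K) ∷ replicates v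

multiplicities : (K : ℕ) → List ℕ → Vec ℕ K
multiplicities K l = Vec.map length (Parts.runs K l)

fromMultiplicities : ∀ {K} → Vec ℕ K → List ℕ
fromMultiplicities v = Parts.concatRuns (replicates v)

replicates-AreRuns : ∀ {K} (v : Vec ℕ K) → Parts.AreRuns (replicates v)
replicates-AreRuns [] = tt
replicates-AreRuns {suc K} (c ∷ v) = AllP.replicate⁺ c refl , replicates-AreRuns v

replicates-lengths : ∀ {K} (rs : Vec (List ℕ) K) → Parts.AreRuns rs → replicates (Vec.map length rs) ≡ rs
replicates-lengths [] _ = refl
replicates-lengths {suc K} (r ∷ rs) (r-run , rs-runs) = cong₂ _∷_ (replicate-run r r-run) (replicates-lengths rs rs-runs)
  where
  replicate-run : ∀ r → All (_≡ suc K) r → replicate (length r) (suc K) ≡ r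
  replicate-run [] [] = refl
  replicate-run (a ∷ r) (a≡ ∷ r-run) = cong₂ _∷_ (sym a≡) (replicate-run r r-run)

lengths-replicates : ∀ {K} (v : Vec ℕ K) → Vec.map length (replicates v) ≡ v
lengths-replicates [] = refl
lengths-replicates (c ∷ v) = cong₂ _∷_ (ListP.length-replicate c) (lengths-replicates v)

multiplicities-fromMultiplicities : ∀ {K} (v : Vec ℕ K) → multiplicities K (fromMultiplicities v) ≡ v
multiplicities-fromMultiplicities v =
  trans (cong (Vec.map length) (Parts.runs-concat (replicates v) (replicates-AreRuns v))) (lengths-replicates v)

fromMultiplicities-multiplicities : ∀ K {l} → IsPartition l → All (_≤ K) l → fromMultiplicities (multiplicities K l) ≡ l
fromMultiplicities-multiplicities K {l} p l≤K =
  trans (cong Parts.concatRuns (replicates-lengths (Parts.runs K l) (Parts.runs-AreRuns K l)))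
        (Parts.concat-runs K l (subst IsPartition (sym (ListP.map-id l)) p) l≤K)

fromMultiplicities-isPartition : ∀ {K} (v : Vec ℕ K) → IsPartition (fromMultiplicities v)
fromMultiplicities-isPartition v =
  subst IsPartition (ListP.map-id _) (Parts.concatRuns-isPartition (replicates v) (replicates-AreRuns v))

sum-fromMultiplicities : ∀ {K} (v : Vec ℕ K) → sum (fromMultiplicities v) ≡ weightedSum id v
sum-fromMultiplicities v = begin
  sum (fromMultiplicities v)              ≡⟨ cong sum (sym (ListP.map-id (fromMultiplicities v))) ⟩
  sum (map id (fromMultiplicities v))     ≡⟨ Parts.sum-concatRuns (replicates v) (replicates-AreRuns v) ⟩
  weightedSum length (replicates v)       ≡⟨ weightedSum-lengths v ⟩
  weightedSum id v ∎
  where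
  open ≡-Reasoning
  weightedSum-lengths : ∀ {K} (v : Vec ℕ K) → weightedSum length (replicates v) ≡ weightedSum id v
  weightedSum-lengths [] = refl
  weightedSum-lengths {suc K} (c ∷ v) = cong₂ _+_ (cong (_* suc K) (ListP.length-replicate c)) (weightedSum-lengths v)

indicator : (K : ℕ) → List ℕ → Vec Bool K
indicator zero l = []
indicator (suc K) [] = false ∷ indicator K []
indicator (suc K) (a ∷ l) with a ≟ suc K
... | yes _ = true ∷ indicator K l
... | no _ = false ∷ indicator K (a ∷ l)

fromIndicator : ∀ {K} → Vec Bool K → List ℕ
fromIndicator [] = []
fromIndicator {suc K} (true ∷ v) = suc K ∷ fromIndicator v
fromIndicator (false ∷ v) = fromIndicator v

fromIndicator-bounded : ∀ {K} (v : Vec Bool K) → All (_≤ K) (fromIndicator v)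
fromIndicator-bounded [] = []
fromIndicator-bounded {suc K} (true ∷ v) = ≤-refl ∷ All≤-weaken (n≤1+n K) (fromIndicator-bounded v)
fromIndicator-bounded (false ∷ v) = All≤-weaken (n≤1+n _) (fromIndicator-bounded v)

fromIndicator-positive : ∀ {K} (v : Vec Bool K) → All (0 <_) (fromIndicator v)
fromIndicator-positive [] = []
fromIndicator-positive {suc K} (true ∷ v) = s≤s z≤n ∷ fromIndicator-positive v
fromIndicator-positive (false ∷ v) = fromIndicator-positive v

fromIndicator-distinct : ∀ {K} (v : Vec Bool K) → Linked _>_ (fromIndicator v)
fromIndicator-distinct [] = []
fromIndicator-distinct {suc K} (true ∷ v) with fromIndicator v | fromIndicator-bounded v | fromIndicator-distinct v
... | [] | _ | _ = [-]
... | _ ∷ _ | a≤K ∷ _ | distinct = s≤s a≤K ∷ distinct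
fromIndicator-distinct (false ∷ v) = fromIndicator-distinct v

fromIndicator-isPartition : ∀ {K} (v : Vec Bool K) → IsPartition (fromIndicator v)
fromIndicator-isPartition v = Linked.map <⇒≤ (fromIndicator-distinct v) , fromIndicator-positive v

sum-fromIndicator : ∀ {K} (v : Vec Bool K) → sum (fromIndicator v) ≡ weightedSum bit v
sum-fromIndicator [] = refl
sum-fromIndicator {suc K} (true ∷ v) = cong₂ _+_ (sym (+-identityʳ (suc K))) (sum-fromIndicator v)
sum-fromIndicator (false ∷ v) = sum-fromIndicator v

indicator-top : ∀ K l → indicator (suc K) (suc K ∷ l) ≡ true ∷ indicator K l
indicator-top K l with suc K ≟ suc K
... | yes _ = refl
... | no ne = ⊥-elim (ne refl)

indicator-below : ∀ K l → All (_≤ K) l → indicator (suc K) l ≡ false ∷ indicator K l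
indicator-below K [] _ = refl
indicator-below K (a ∷ l) (a≤K ∷ _) with a ≟ suc K
... | yes refl = ⊥-elim (1+n≰n a≤K)
... | no _ = refl

indicator-fromIndicator : ∀ {K} (v : Vec Bool K) → indicator K (fromIndicator v) ≡ v
indicator-fromIndicator [] = refl
indicator-fromIndicator {suc K} (true ∷ v) =
  trans (indicator-top K (fromIndicator v)) (cong (true ∷_) (indicator-fromIndicator v))
indicator-fromIndicator {suc K} (false ∷ v) =
  trans (indicator-below K (fromIndicator v) (fromIndicator-bounded v)) (cong (false ∷_) (indicator-fromIndicator v))

distinct-<head : ∀ {a l} → Linked _>_ (a ∷ l) → All (_< a) l
distinct-<head [-] = []
distinct-<head (a>b ∷ lk) = Linked⇒All (λ x>y y>z → <-trans y>z x>y) a>b lk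

fromIndicator-indicator : ∀ K {l} → Linked _>_ l → All (0 <_) l → All (_≤ K) l → fromIndicator (indicator K l) ≡ l
fromIndicator-indicator zero {[]} _ _ _ = refl
fromIndicator-indicator zero {a ∷ l} _ (pos ∷ _) (a≤0 ∷ _) = ⊥-elim (<⇒≱ pos a≤0)
fromIndicator-indicator (suc K) {[]} _ _ _ = fromIndicator-indicator K [] [] []
fromIndicator-indicator (suc K) {a ∷ l} distinct (pos ∷ l-pos) (a≤1+K ∷ _) with a ≟ suc K
... | yes refl = cong (suc K ∷_)
  (fromIndicator-indicator K (Linked.tail distinct) l-pos (All.map ≤-pred (distinct-<head distinct)))
... | no a≢1+K = fromIndicator-indicator K distinct (pos ∷ l-pos)
  (a≤K ∷ All.map (λ b<a → ≤-trans (<⇒≤ b<a) a≤K) (distinct-<head distinct))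
  where a≤K = ≤-pred (≤∧≢⇒< a≤1+K a≢1+K)

multiplicity : Maybe (ℕ × ℕ) → ℕ
multiplicity nothing = 0
multiplicity (just (a , b)) = suc (a + b)

tagsOf : Maybe (ℕ × ℕ) → List Bool
tagsOf nothing = []
tagsOf (just (a , b)) = replicate a false ++ true ∷ replicate b false

designation : List Bool → Maybe (ℕ × ℕ)
designation [] = nothing
designation (true ∷ bs) = just (0 , zeros bs)
designation (false ∷ bs) = mapMaybe (map₁ suc) (designation bs)

designation-tagsOf : ∀ d → designation (tagsOf d) ≡ d
designation-tagsOf nothing = refl
designation-tagsOf (just (zero , b)) = cong (λ k → just (0 , k)) (zeros-replicate-false b)
designation-tagsOf (just (suc a , b)) rewrite designation-tagsOf (just (a , b)) = refl

tagsOf-designation : ∀ bs → ones bs ≡ 1 → tagsOf (designation bs) ≡ bs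
tagsOf-designation (true ∷ bs) e = cong (true ∷_) (sym (ones≡0⇒allFalse bs (suc-injective e)))
tagsOf-designation (false ∷ bs) e with designation bs | tagsOf-designation bs e
... | nothing | refl with () ← e
... | just (a , b) | tags≡ = cong (false ∷_) tags≡

ones-tagsOf : ∀ a b → ones (tagsOf (just (a , b))) ≡ 1
ones-tagsOf zero b = cong suc (ones-replicate-false b)
ones-tagsOf (suc a) b = ones-tagsOf a b

length-tagsOf : ∀ d → length (tagsOf d) ≡ multiplicity d
length-tagsOf nothing = refl
length-tagsOf (just (a , b)) = begin
  length (replicate a false ++ true ∷ replicate b false)   ≡⟨ ListP.length-++ (replicate a false) ⟩
  length (replicate a false) + suc (length (replicate b false))
    ≡⟨ cong₂ (λ x y → x + suc y) (ListP.length-replicate a) (ListP.length-replicate b) ⟩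
  a + suc b                                                  ≡⟨ +-suc a b ⟩
  suc (a + b) ∎
  where open ≡-Reasoning

module Tagged = GroupBySize {ℕ × Bool} proj₁

taggedRuns : ∀ {K} → Vec (Maybe (ℕ × ℕ)) K → Vec (List (ℕ × Bool)) K
taggedRuns [] = []
taggedRuns {suc K} (d ∷ v) = map (suc K ,_) (tagsOf d) ∷ taggedRuns v

designations : (K : ℕ) → List (ℕ × Bool) → Vec (Maybe (ℕ × ℕ)) K
designations K xs = Vec.map (designation ∘ map proj₂) (Tagged.runs K xs)

fromDesignations : ∀ {K} → Vec (Maybe (ℕ × ℕ)) K → List (ℕ × Bool)
fromDesignations v = Tagged.concatRuns (taggedRuns v)

tags-map-size : ∀ (s : ℕ) (bs : List Bool) → map proj₂ (map (s ,_) bs) ≡ bs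
tags-map-size s bs = trans (sym (ListP.map-∘ bs)) (ListP.map-id bs)

run-map-tags : ∀ (s : ℕ) (r : List (ℕ × Bool)) → All (Tagged.HasSize s) r → map (s ,_) (map proj₂ r) ≡ r
run-map-tags s r r-run = trans (sym (ListP.map-∘ r)) (ListP.map-id-local (All.map (λ e → cong (_, _) (sym e)) r-run))

taggedRuns-AreRuns : ∀ {K} (v : Vec (Maybe (ℕ × ℕ)) K) → Tagged.AreRuns (taggedRuns v)
taggedRuns-AreRuns [] = tt
taggedRuns-AreRuns {suc K} (d ∷ v) = AllP.map⁺ (All.universal (λ _ → refl) (tagsOf d)) , taggedRuns-AreRuns v

designations-fromDesignations : ∀ {K} (v : Vec (Maybe (ℕ × ℕ)) K) → designations K (fromDesignations v) ≡ v
designations-fromDesignations v =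
  trans (cong (Vec.map (designation ∘ map proj₂)) (Tagged.runs-concat (taggedRuns v) (taggedRuns-AreRuns v)))
        (designations-taggedRuns v)
  where
  designations-taggedRuns : ∀ {K} (v : Vec (Maybe (ℕ × ℕ)) K) → Vec.map (designation ∘ map proj₂) (taggedRuns v) ≡ v
  designations-taggedRuns [] = refl
  designations-taggedRuns {suc K} (d ∷ v) =
    cong₂ _∷_ (trans (cong designation (tags-map-size (suc K) (tagsOf d))) (designation-tagsOf d)) (designations-taggedRuns v)

≡ᵇ-refl : ∀ s → (s ≡ᵇ s) ≡ true
≡ᵇ-refl s = dec-true (s ≟ s) refl

≢⇒≡ᵇ≡false : ∀ {a k} → a ≢ k → (a ≡ᵇ k) ≡ false
≢⇒≡ᵇ≡false {a} {k} = dec-false (a ≟ k)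

designatedCount-++ : ∀ k xs ys → designatedCount k (xs ++ ys) ≡ designatedCount k xs + designatedCount k ys
designatedCount-++ k [] ys = refl
designatedCount-++ k ((a , b) ∷ xs) ys =
  trans (cong (_ +_) (designatedCount-++ k xs ys))
        (sym (+-assoc (if b ∧ (a ≡ᵇ k) then 1 else 0) (designatedCount k xs) (designatedCount k ys)))

designatedCount-run : ∀ s r → All (Tagged.HasSize s) r → designatedCount s r ≡ ones (map proj₂ r)
designatedCount-run s [] [] = refl
designatedCount-run s ((.s , true) ∷ r) (refl ∷ r-run) rewrite ≡ᵇ-refl s = cong suc (designatedCount-run s r r-run)
designatedCount-run s ((.s , false) ∷ r) (refl ∷ r-run) = designatedCount-run s r r-run

designatedCount-absent : ∀ k ys → All (λ y → proj₁ y ≢ k) ys → designatedCount k ys ≡ 0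
designatedCount-absent k [] [] = refl
designatedCount-absent k ((a , true) ∷ ys) (a≢k ∷ ys≢k) rewrite ≢⇒≡ᵇ≡false a≢k = designatedCount-absent k ys ys≢k
designatedCount-absent k ((a , false) ∷ ys) (_ ∷ ys≢k) = designatedCount-absent k ys ys≢k

-- Vacuous for the empty run.
DesignatedRun : List (ℕ × Bool) → Set
DesignatedRun r = All (λ _ → ones (map proj₂ r) ≡ 1) r

module _ {s} {r ys : List (ℕ × Bool)} (r-run : All (Tagged.HasSize s) r) (ys<s : All (λ y → proj₁ y < s) ys) where
  private
    count-top : designatedCount s (r ++ ys) ≡ ones (map proj₂ r)
    count-top = begin
      designatedCount s (r ++ ys)                   ≡⟨ designatedCount-++ s r ys ⟩
      designatedCount s r + designatedCount s ys    ≡⟨ cong₂ _+_ (designatedCount-run s r r-run)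
                                                                 (designatedCount-absent s ys (All.map <⇒≢ ys<s)) ⟩
      ones (map proj₂ r) + 0                        ≡⟨ +-identityʳ _ ⟩
      ones (map proj₂ r) ∎
      where open ≡-Reasoning

    count-below : ∀ k → k < s → designatedCount k (r ++ ys) ≡ designatedCount k ys
    count-below k k<s = trans (designatedCount-++ k r ys)
      (cong (_+ designatedCount k ys)
            (designatedCount-absent k r (All.map (λ a≡s a≡k → <⇒≢ k<s (trans (sym a≡k) a≡s)) r-run)))

  ExactlyOneDesignated-++⁻ : ExactlyOneDesignated (r ++ ys) → DesignatedRun r × ExactlyOneDesignated ys
  ExactlyOneDesignated-++⁻ one with AllP.++⁻ r one
  ... | one-r , one-ys =
    All.zipWith (λ (a≡s , once) → trans (sym count-top) (subst (λ k → designatedCount k (r ++ ys) ≡ 1) a≡s once))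
                (r-run , one-r) ,
    All.zipWith (λ (y<s , once) → trans (sym (count-below _ y<s)) once) (ys<s , one-ys)

  ExactlyOneDesignated-++⁺ : DesignatedRun r → ExactlyOneDesignated ys → ExactlyOneDesignated (r ++ ys)
  ExactlyOneDesignated-++⁺ one-r one-ys = AllP.++⁺
    (All.zipWith (λ (a≡s , once) → subst (λ k → designatedCount k (r ++ ys) ≡ 1) (sym a≡s) (trans count-top once))
                 (r-run , one-r))
    (All.zipWith (λ (y<s , once) → trans (count-below _ y<s) once) (ys<s , one-ys))

ExactlyOneDesignated-concatRuns⁻ : ∀ {K} (rs : Vec (List (ℕ × Bool)) K) → Tagged.AreRuns rs →
  ExactlyOneDesignated (Tagged.concatRuns rs) → VecAll.All DesignatedRun rs
ExactlyOneDesignated-concatRuns⁻ [] _ _ = []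
ExactlyOneDesignated-concatRuns⁻ (r ∷ rs) (r-run , rs-runs) one
  with ExactlyOneDesignated-++⁻ r-run (All.map s≤s (Tagged.concatRuns-bounded rs rs-runs)) one
... | one-r , one-rs = one-r ∷ ExactlyOneDesignated-concatRuns⁻ rs rs-runs one-rs

ExactlyOneDesignated-concatRuns⁺ : ∀ {K} (rs : Vec (List (ℕ × Bool)) K) → Tagged.AreRuns rs →
  VecAll.All DesignatedRun rs → ExactlyOneDesignated (Tagged.concatRuns rs)
ExactlyOneDesignated-concatRuns⁺ [] _ _ = []
ExactlyOneDesignated-concatRuns⁺ (r ∷ rs) (r-run , rs-runs) (one-r ∷ one-rs) =
  ExactlyOneDesignated-++⁺ r-run (All.map s≤s (Tagged.concatRuns-bounded rs rs-runs)) one-r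
    (ExactlyOneDesignated-concatRuns⁺ rs rs-runs one-rs)

taggedRuns-designated : ∀ {K} (v : Vec (Maybe (ℕ × ℕ)) K) → VecAll.All DesignatedRun (taggedRuns v)
taggedRuns-designated [] = []
taggedRuns-designated (nothing ∷ v) = [] ∷ taggedRuns-designated v
taggedRuns-designated {suc K} (just (a , b) ∷ v) =
  All.universal (λ _ → trans (cong ones (tags-map-size (suc K) (tagsOf (just (a , b))))) (ones-tagsOf a b)) _
  ∷ taggedRuns-designated v

taggedRuns-designations : ∀ {K} (rs : Vec (List (ℕ × Bool)) K) → Tagged.AreRuns rs → VecAll.All DesignatedRun rs →
                          taggedRuns (Vec.map (designation ∘ map proj₂) rs) ≡ rs
taggedRuns-designations [] _ _ = refl
taggedRuns-designations ([] ∷ rs) (_ , rs-runs) (_ ∷ one-rs) = cong ([] ∷_) (taggedRuns-designations rs rs-runs one-rs)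
taggedRuns-designations {suc K} (r@(_ ∷ _) ∷ rs) (r-run , rs-runs) ((once ∷ _) ∷ one-rs) = cong₂ _∷_
  (trans (cong (map (suc K ,_)) (tagsOf-designation (map proj₂ r) once)) (run-map-tags (suc K) r r-run))
  (taggedRuns-designations rs rs-runs one-rs)

fromDesignations-designations : ∀ K {xs} → IsPartition (map proj₁ xs) → All (λ x → proj₁ x ≤ K) xs →
  ExactlyOneDesignated xs → fromDesignations (designations K xs) ≡ xs
fromDesignations-designations K {xs} p xs≤K one = trans
  (cong Tagged.concatRuns (taggedRuns-designations rs rs-runs
    (ExactlyOneDesignated-concatRuns⁻ rs rs-runs (subst ExactlyOneDesignated (sym concat≡) one))))
  concat≡
  where
  rs = Tagged.runs K xs
  rs-runs = Tagged.runs-AreRuns K xs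
  concat≡ = Tagged.concat-runs K xs p xs≤K

fromDesignations-isPartition : ∀ {K} (v : Vec (Maybe (ℕ × ℕ)) K) → IsPartition (map proj₁ (fromDesignations v))
fromDesignations-isPartition v = Tagged.concatRuns-isPartition (taggedRuns v) (taggedRuns-AreRuns v)

fromDesignations-exactlyOne : ∀ {K} (v : Vec (Maybe (ℕ × ℕ)) K) → ExactlyOneDesignated (fromDesignations v)
fromDesignations-exactlyOne v =
  ExactlyOneDesignated-concatRuns⁺ (taggedRuns v) (taggedRuns-AreRuns v) (taggedRuns-designated v)

sum-fromDesignations : ∀ {K} (v : Vec (Maybe (ℕ × ℕ)) K) →
                       sum (map proj₁ (fromDesignations v)) ≡ weightedSum multiplicity v
sum-fromDesignations v = trans (Tagged.sum-concatRuns (taggedRuns v) (taggedRuns-AreRuns v)) (weightedSum-taggedRuns v)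
  where
  weightedSum-taggedRuns : ∀ {K} (v : Vec (Maybe (ℕ × ℕ)) K) →
                           weightedSum length (taggedRuns v) ≡ weightedSum multiplicity v
  weightedSum-taggedRuns [] = refl
  weightedSum-taggedRuns {suc K} (d ∷ v) = cong₂ _+_
    (cong (_* suc K) (trans (ListP.length-map {B = ℕ × Bool} (suc K ,_) (tagsOf d)) (length-tagsOf d)))
    (weightedSum-taggedRuns v)

-- Splitting a run

weight₃₂₁ : Bool × ℕ × ℕ → ℕ
weight₃₂₁ (e , x , y) = bit e * 3 + x * 2 + y

addPair : Bool × ℕ × ℕ → Bool × ℕ × ℕ
addPair (e , x , y) = e , suc x , y

growRun : Maybe (ℕ × ℕ) → Maybe (ℕ × ℕ)
growRun nothing = just (1 , 0)
growRun (just (a , b)) = just (suc a , suc b)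

-- Pairs of parts, one before and one after the designated part, are peeled off into x; what remains is
-- (0 , b), (1 , 0) or (a + 2 , 0), of weight b + 1, 2 and a + 3.
splitRun : Maybe (ℕ × ℕ) → Bool × ℕ × ℕ
splitRun nothing = false , 0 , 0
splitRun (just (zero , b)) = false , 0 , suc b
splitRun (just (suc a , suc b)) = addPair (splitRun (just (a , b)))
splitRun (just (suc zero , zero)) = addPair (splitRun nothing)
splitRun (just (suc (suc a) , zero)) = true , 0 , a

joinRun : Bool × ℕ × ℕ → Maybe (ℕ × ℕ)
joinRun (e , suc x , y) = growRun (joinRun (e , x , y))
joinRun (false , zero , zero) = nothing
joinRun (false , zero , suc y) = just (0 , y)
joinRun (true , zero , y) = just (suc (suc y) , 0)

splitRun-growRun : ∀ d → splitRun (growRun d) ≡ addPair (splitRun d)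
splitRun-growRun nothing = refl
splitRun-growRun (just (a , b)) = refl

splitRun-joinRun : ∀ t → splitRun (joinRun t) ≡ t
splitRun-joinRun (e , suc x , y) =
  trans (splitRun-growRun (joinRun (e , x , y))) (cong addPair (splitRun-joinRun (e , x , y)))
splitRun-joinRun (false , zero , zero) = refl
splitRun-joinRun (false , zero , suc y) = refl
splitRun-joinRun (true , zero , y) = refl

joinRun-splitRun : ∀ d → joinRun (splitRun d) ≡ d
joinRun-splitRun nothing = refl
joinRun-splitRun (just (zero , b)) = refl
joinRun-splitRun (just (suc a , suc b)) = cong growRun (joinRun-splitRun (just (a , b)))
joinRun-splitRun (just (suc zero , zero)) = refl
joinRun-splitRun (just (suc (suc a) , zero)) = refl

weight₃₂₁-splitRun : ∀ d → weight₃₂₁ (splitRun d) ≡ multiplicity d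
weight₃₂₁-splitRun nothing = refl
weight₃₂₁-splitRun (just (zero , b)) = refl
weight₃₂₁-splitRun (just (suc a , suc b)) = begin
  weight₃₂₁ (addPair t)   ≡⟨ rearrange (bit (proj₁ t)) (proj₁ (proj₂ t)) (proj₂ (proj₂ t)) ⟩
  2 + weight₃₂₁ t         ≡⟨ cong (2 +_) (weight₃₂₁-splitRun (just (a , b))) ⟩
  2 + suc (a + b)         ≡⟨ cong (2 +_) (sym (+-suc a b)) ⟩
  suc (suc a + suc b) ∎
  where
  open ≡-Reasoning
  t = splitRun (just (a , b))
  rearrange : ∀ e x y → e * 3 + suc x * 2 + y ≡ 2 + (e * 3 + x * 2 + y)
  rearrange = solve-∀
weight₃₂₁-splitRun (just (suc zero , zero)) = refl
weight₃₂₁-splitRun (just (suc (suc a) , zero)) = cong (3 +_) (sym (+-identityʳ a))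

splitRuns : ∀ {K} → Vec (Maybe (ℕ × ℕ)) K → Vec Bool K × Vec ℕ K × Vec ℕ K
splitRuns [] = [] , [] , []
splitRuns (d ∷ v) = let (e , x , y) = splitRun d ; (es , xs , ys) = splitRuns v in e ∷ es , x ∷ xs , y ∷ ys

joinRuns : ∀ {K} → Vec Bool K × Vec ℕ K × Vec ℕ K → Vec (Maybe (ℕ × ℕ)) K
joinRuns ([] , [] , []) = []
joinRuns (e ∷ es , x ∷ xs , y ∷ ys) = joinRun (e , x , y) ∷ joinRuns (es , xs , ys)

joinRuns-splitRuns : ∀ {K} (v : Vec (Maybe (ℕ × ℕ)) K) → joinRuns (splitRuns v) ≡ v
joinRuns-splitRuns [] = refl
joinRuns-splitRuns (d ∷ v) = cong₂ _∷_ (joinRun-splitRun d) (joinRuns-splitRuns v)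

splitRuns-joinRuns : ∀ {K} (t : Vec Bool K × Vec ℕ K × Vec ℕ K) → splitRuns (joinRuns t) ≡ t
splitRuns-joinRuns ([] , [] , []) = refl
splitRuns-joinRuns (e ∷ es , x ∷ xs , y ∷ ys)
  rewrite splitRun-joinRun (e , x , y) | splitRuns-joinRuns (es , xs , ys) = refl

weightedSum₃₂₁ : ∀ {K} → Vec Bool K × Vec ℕ K × Vec ℕ K → ℕ
weightedSum₃₂₁ (es , xs , ys) = weightedSum bit es * 3 + weightedSum id xs * 2 + weightedSum id ys

weightedSum-splitRuns : ∀ {K} (v : Vec (Maybe (ℕ × ℕ)) K) → weightedSum multiplicity v ≡ weightedSum₃₂₁ (splitRuns v)
weightedSum-splitRuns [] = refl
weightedSum-splitRuns {suc K} (d ∷ v) = trans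
  (cong₂ (λ a b → a * suc K + b) (sym (weight₃₂₁-splitRun d)) (weightedSum-splitRuns v))
  (distribute (bit e) x y (suc K) (weightedSum bit es) (weightedSum id xs) (weightedSum id ys))
  where
  e = proj₁ (splitRun d)
  x = proj₁ (proj₂ (splitRun d))
  y = proj₂ (proj₂ (splitRun d))
  es = proj₁ (splitRuns v)
  xs = proj₁ (proj₂ (splitRuns v))
  ys = proj₂ (proj₂ (splitRuns v))
  distribute : ∀ e x y k E X Y →
    (e * 3 + x * 2 + y) * k + (E * 3 + X * 2 + Y) ≡ (e * k + E) * 3 + (x * k + X) * 2 + (y * k + Y)
  distribute = solve-∀

-- Scaling and staircases

module Scaling (d : ℕ) .{{_ : NonZero d}} where

  scale : List ℕ → List ℕ
  scale = map (_* d)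

  unscale : List ℕ → List ℕ
  unscale = map (_/ d)

  unscale-scale : ∀ l → unscale (scale l) ≡ l
  unscale-scale l = trans (sym (ListP.map-∘ l)) (ListP.map-id-local (All.universal (λ x → m*n/n≡m x d) l))

  scale-unscale : ∀ {l} → All (d ∣_) l → scale (unscale l) ≡ l
  scale-unscale d∣l = trans (sym (ListP.map-∘ _)) (ListP.map-id-local (All.map m/n*n≡m d∣l))

  sum-scale : ∀ l → sum (scale l) ≡ sum l * d
  sum-scale [] = refl
  sum-scale (x ∷ l) = trans (cong (x * d +_) (sum-scale l)) (sym (*-distribʳ-+ d x (sum l)))

  scale-divisible : ∀ l → All (d ∣_) (scale l)
  scale-divisible l = AllP.map⁺ (All.universal (λ x → divides x refl) l)

  scale-isPartition : ∀ {l} → IsPartition l → IsPartition (scale l)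
  scale-isPartition (lk , pos) = LinkedP.map⁺ (Linked.map (*-monoˡ-≤ d) lk) , AllP.map⁺ (All.map (*-monoˡ-< d) pos)

  scale-distinct : ∀ {l} → Linked _>_ l → Linked _>_ (scale l)
  scale-distinct lk = LinkedP.map⁺ (Linked.map (*-monoˡ-< d) lk)

  unscale-bounded : ∀ {l k} → All (_≤ k) l → All (_≤ k) (unscale l)
  unscale-bounded l≤k = AllP.map⁺ (All.map (λ {x} x≤k → ≤-trans (m/n≤m x d) x≤k) l≤k)

  unscale-positive : ∀ {l} → All (d ∣_) l → All (0 <_) l → All (0 <_) (unscale l)
  unscale-positive d∣l pos = AllP.map⁺ (All.zipWith positive (d∣l , pos))
    where
    positive : ∀ {x} → d ∣ x × 0 < x → 0 < x / d
    positive {x} (d∣x , x>0) with x / d | m/n*n≡m {x} {d} d∣x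
    ... | zero | x≡0 = ⊥-elim (<-irrefl x≡0 x>0)
    ... | suc _ | _ = s≤s z≤n

  unscale-distinct : ∀ {l} → All (d ∣_) l → Linked _>_ l → Linked _>_ (unscale l)
  unscale-distinct _ [] = []
  unscale-distinct _ [-] = [-]
  unscale-distinct {x ∷ y ∷ _} (d∣x ∷ d∣y ∷ d∣l) (x>y ∷ lk) =
    *-cancelʳ-< d (y / d) (x / d) (subst₂ _<_ (sym (m/n*n≡m d∣y)) (sym (m/n*n≡m d∣x)) x>y)
    ∷ unscale-distinct (d∣y ∷ d∣l) lk

  unscale-isPartition : ∀ {l} → All (d ∣_) l → IsPartition l → IsPartition (unscale l)
  unscale-isPartition d∣l (lk , pos) = LinkedP.map⁺ (Linked.map (/-monoˡ-≤ d) lk) , unscale-positive d∣l pos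

sum-staircase : ∀ m → sum (staircase m) ≡ choose₂ (suc m)
sum-staircase zero = refl
sum-staircase (suc m) = trans (cong (suc m +_) (sum-staircase m)) (+-comm (suc m) _)

staircase-isPartition : ∀ m → IsPartition (staircase m)
staircase-isPartition zero = [] , []
staircase-isPartition (suc m) = IsPartition-∷ (s≤s z≤n) (staircase-bounded m) (staircase-isPartition m)
  where
  staircase-bounded : ∀ m → All (_≤ suc m) (staircase m)
  staircase-bounded zero = []
  staircase-bounded (suc m) = n≤1+n (suc m) ∷ All≤-weaken (n≤1+n (suc m)) (staircase-bounded m)

staircase-injective : ∀ {m m′} → staircase m ≡ staircase m′ → m ≡ m′
staircase-injective {zero} {zero} _ = refl
staircase-injective {suc m} {suc m′} e = cong suc (staircase-injective (ListP.∷-injectiveʳ e))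

IsPartition-irrelevant : ∀ {l} (p q : IsPartition l) → p ≡ q
IsPartition-irrelevant (lk , pos) (lk′ , pos′) =
  cong₂ _,_ (Linked.irrelevant ≤-irrelevant lk lk′) (All.irrelevant <-irrelevant pos pos′)

∣-irrelevant : ∀ {d x} .{{_ : NonZero d}} (p q : d ∣ x) → p ≡ q
∣-irrelevant {d} (divides a e) (divides b e′) with *-cancelʳ-≡ a b d (trans (sym e) e′)
... | refl = cong (divides a) (≡-irrelevant e e′)

IsStaircase-irrelevant : ∀ {l} (p q : IsStaircase l) → p ≡ q
IsStaircase-irrelevant (m , e) (m′ , e′) with staircase-injective (trans (sym e) e′)
... | refl = cong (m ,_) (Decidable⇒UIP.≡-irrelevant (ListP.≡-dec _≟_) e e′)

Σ-≡-irrelevant : ∀ {A : Set} {P : A → Set} → (∀ x (p q : P x) → p ≡ q) → {a b : Σ A P} → proj₁ a ≡ proj₁ b → a ≡ b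
Σ-≡-irrelevant irr {a , p} {.a , q} refl = cong (a ,_) (irr a p q)

-- (e , x , m , α , β) stands for λ⁽⁵⁾ = 3 · {k | e_k}, λ⁽³⁾ = 2 · (x_k parts k), λ⁽⁴⁾ = staircase m,
-- λ⁽¹⁾ = 2α and λ⁽²⁾ = 2β.
Coordinates : ℕ → Set
Coordinates n = Vec Bool n × Vec ℕ n × ℕ × List ℕ × List ℕ

weight : ∀ {n} → Coordinates n → ℕ
weight (es , xs , m , α , β) = weightedSum bit es * 3 + weightedSum id xs * 2 + (2 * (sum α + sum β) + choose₂ (suc m))

AreValid : (n : ℕ) → Coordinates n → Set
AreValid n (es , xs , m , α , β) = IsPartition α × IsPartition β × weight (es , xs , m , α , β) ≡ n

AreValid-irrelevant : ∀ {n} c (p q : AreValid n c) → p ≡ q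
AreValid-irrelevant _ (pα , pβ , w) (pα′ , pβ′ , w′) =
  cong₂ _,_ (IsPartition-irrelevant pα pα′) (cong₂ _,_ (IsPartition-irrelevant pβ pβ′) (≡-irrelevant w w′))

ValidCoordinates : ℕ → Set
ValidCoordinates n = Σ (Coordinates n) (AreValid n)

fromTwoQuotient-bounded : ∀ {n} c → AreValid n c → let (_ , _ , m , α , β) = c in All (_≤ n) (fromTwoQuotient m α β)
fromTwoQuotient-bounded (es , xs , m , α , β) (pα , pβ , w) =
  All≤-weaken (≤-trans (≤-reflexive (fromTwoQuotient-size m pα pβ))
                       (≤-trans (m≤n+m _ (weightedSum bit es * 3 + weightedSum id xs * 2)) (≤-reflexive w)))
              (parts≤sum _)

sum-fromDesignations-joinRuns : ∀ {K} (t : Vec Bool K × Vec ℕ K × Vec ℕ K) →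
                                sum (map proj₁ (fromDesignations (joinRuns t))) ≡ weightedSum₃₂₁ t
sum-fromDesignations-joinRuns t = begin
  sum (map proj₁ (fromDesignations (joinRuns t)))   ≡⟨ sum-fromDesignations (joinRuns t) ⟩
  weightedSum multiplicity (joinRuns t)             ≡⟨ weightedSum-splitRuns (joinRuns t) ⟩
  weightedSum₃₂₁ (splitRuns (joinRuns t))           ≡⟨ cong weightedSum₃₂₁ (splitRuns-joinRuns t) ⟩
  weightedSum₃₂₁ t ∎
  where open ≡-Reasoning

module DesignatedSide (n : ℕ) where

  IsDesignated : List (ℕ × Bool) → Set
  IsDesignated xs = IsPartition (map proj₁ xs) × ExactlyOneDesignated xs × sum (map proj₁ xs) ≡ n

  toCoordinates : List (ℕ × Bool) → Coordinates n
  toCoordinates xs = let (es , xs′ , ys) = splitRuns (designations n xs) in es , xs′ , twoQuotient (fromMultiplicities ys)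

  fromCoordinates : Coordinates n → List (ℕ × Bool)
  fromCoordinates (es , xs , m , α , β) = fromDesignations (joinRuns (es , xs , multiplicities n (fromTwoQuotient m α β)))

  sizes-bounded : ∀ (xs : List (ℕ × Bool)) → sum (map proj₁ xs) ≡ n → All (λ x → proj₁ x ≤ n) xs
  sizes-bounded xs size = AllP.map⁻ (subst (λ k → All (_≤ k) (map proj₁ xs)) size (parts≤sum (map proj₁ xs)))

  toCoordinates-valid : ∀ xs → IsDesignated xs → AreValid n (toCoordinates xs)
  toCoordinates-valid xs (p , one , size) = twoQuotient-isPartition μ .proj₁ , twoQuotient-isPartition μ .proj₂ , (begin
    weightedSum bit es * 3 + weightedSum id xs′ * 2 + (2 * (sum α + sum β) + choose₂ (suc m))
      ≡⟨ cong (weightedSum bit es * 3 + weightedSum id xs′ * 2 +_) (twoQuotient-size μ (fromMultiplicities-isPartition ys)) ⟨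
    weightedSum bit es * 3 + weightedSum id xs′ * 2 + sum μ
      ≡⟨ cong (weightedSum bit es * 3 + weightedSum id xs′ * 2 +_) (sum-fromMultiplicities ys) ⟩
    weightedSum₃₂₁ (splitRuns v)                   ≡⟨ sym (weightedSum-splitRuns v) ⟩
    weightedSum multiplicity v                     ≡⟨ sym (sum-fromDesignations v) ⟩
    sum (map proj₁ (fromDesignations v))
      ≡⟨ cong (sum ∘ map proj₁) (fromDesignations-designations n p (sizes-bounded xs size) one) ⟩
    sum (map proj₁ xs)                             ≡⟨ size ⟩
    n ∎)
    where
    open ≡-Reasoning
    v = designations n xs
    es = proj₁ (splitRuns v)
    xs′ = proj₁ (proj₂ (splitRuns v))
    ys = proj₂ (proj₂ (splitRuns v))
    μ = fromMultiplicities ys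
    m = proj₁ (twoQuotient μ)
    α = proj₁ (proj₂ (twoQuotient μ))
    β = proj₂ (proj₂ (twoQuotient μ))

  fromCoordinates-valid : ∀ c → AreValid n c → IsDesignated (fromCoordinates c)
  fromCoordinates-valid c@(es , xs , m , α , β) valid@(pα , pβ , w) =
    fromDesignations-isPartition v , fromDesignations-exactlyOne v , (begin
    sum (map proj₁ (fromDesignations v))     ≡⟨ sum-fromDesignations-joinRuns (es , xs , ys) ⟩
    weightedSum bit es * 3 + weightedSum id xs * 2 + weightedSum id ys
      ≡⟨ cong (weightedSum bit es * 3 + weightedSum id xs * 2 +_) (begin
           weightedSum id ys                           ≡⟨ sum-fromMultiplicities ys ⟨
           sum (fromMultiplicities ys)                 ≡⟨ cong sum (fromMultiplicities-multiplicities n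
                                                              (fromTwoQuotient-isPartition m α β) (fromTwoQuotient-bounded c valid)) ⟩
           sum (fromTwoQuotient m α β)                 ≡⟨ fromTwoQuotient-size m pα pβ ⟩
           2 * (sum α + sum β) + choose₂ (suc m)       ∎) ⟩
    weight c                                 ≡⟨ w ⟩
    n ∎)
    where
    open ≡-Reasoning
    ys = multiplicities n (fromTwoQuotient m α β)
    v = joinRuns (es , xs , ys)

  toCoordinates-fromCoordinates : ∀ c → AreValid n c → toCoordinates (fromCoordinates c) ≡ c
  toCoordinates-fromCoordinates c@(es , xs , m , α , β) valid@(pα , pβ , _)
    rewrite designations-fromDesignations (joinRuns (es , xs , multiplicities n (fromTwoQuotient m α β)))
          | splitRuns-joinRuns (es , xs , multiplicities n (fromTwoQuotient m α β))
          | fromMultiplicities-multiplicities n (fromTwoQuotient-isPartition m α β) (fromTwoQuotient-bounded c valid)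
          | twoQuotient-fromTwoQuotient m pα pβ = refl

  fromCoordinates-toCoordinates : ∀ xs → IsDesignated xs → fromCoordinates (toCoordinates xs) ≡ xs
  fromCoordinates-toCoordinates xs (p , one , size)
    rewrite fromTwoQuotient-twoQuotient _ (fromMultiplicities-isPartition (splitRuns (designations n xs) .proj₂ .proj₂))
          | multiplicities-fromMultiplicities (splitRuns (designations n xs) .proj₂ .proj₂)
          | joinRuns-splitRuns (designations n xs) = fromDesignations-designations n p (sizes-bounded xs size) one

  PD↔Coordinates : PD n ↔ ValidCoordinates n
  PD↔Coordinates = mk↔ₛ′
    (λ (xs , p) → toCoordinates xs , toCoordinates-valid xs p)
    (λ (c , valid) → fromCoordinates c , fromCoordinates-valid c valid)
    (λ (c , valid) → Σ-≡-irrelevant {P = AreValid n} AreValid-irrelevant (toCoordinates-fromCoordinates c valid))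
    (λ (xs , p) → Σ-≡-irrelevant {P = IsDesignated} IsDesignated-irrelevant (fromCoordinates-toCoordinates xs p))
    where
    IsDesignated-irrelevant : ∀ xs (p q : IsDesignated xs) → p ≡ q
    IsDesignated-irrelevant _ (p , one , s) (p′ , one′ , s′) = cong₂ _,_ (IsPartition-irrelevant p p′)
      (cong₂ _,_ (All.irrelevant ≡-irrelevant one one′) (≡-irrelevant s s′))

V25-≡ : ∀ {n} (a b : V25 n) → V25.λ₁ a ≡ V25.λ₁ b → V25.λ₂ a ≡ V25.λ₂ b → V25.λ₃ a ≡ V25.λ₃ b →
        V25.λ₄ a ≡ V25.λ₄ b → V25.λ₅ a ≡ V25.λ₅ b → a ≡ b
V25-≡ record { part₁ = p₁ ; part₂ = p₂ ; part₃ = p₃ ; part₄ = p₄ ; part₅ = p₅ ; total = t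
             ; even₁ = e₁ ; even₂ = e₂ ; even₃ = e₃ ; stair₄ = s₄ ; distinct₅ = d₅ ; div3₅ = t₅ }
      record { part₁ = p₁′ ; part₂ = p₂′ ; part₃ = p₃′ ; part₄ = p₄′ ; part₅ = p₅′ ; total = t′
             ; even₁ = e₁′ ; even₂ = e₂′ ; even₃ = e₃′ ; stair₄ = s₄′ ; distinct₅ = d₅′ ; div3₅ = t₅′ }
      refl refl refl refl refl
  with IsPartition-irrelevant p₁ p₁′ | IsPartition-irrelevant p₂ p₂′ | IsPartition-irrelevant p₃ p₃′
     | IsPartition-irrelevant p₄ p₄′ | IsPartition-irrelevant p₅ p₅′ | ≡-irrelevant t t′
     | All.irrelevant ∣-irrelevant e₁ e₁′ | All.irrelevant ∣-irrelevant e₂ e₂′ | All.irrelevant ∣-irrelevant e₃ e₃′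
     | IsStaircase-irrelevant s₄ s₄′ | Linked.irrelevant <-irrelevant d₅ d₅′ | All.irrelevant ∣-irrelevant t₅ t₅′
... | refl | refl | refl | refl | refl | refl | refl | refl | refl | refl | refl | refl = refl

module Halves = Scaling 2
module Thirds = Scaling 3

module QuintupleSide (n : ℕ) where
  open V25

  totalSize : List ℕ → List ℕ → List ℕ → List ℕ → List ℕ → ℕ
  totalSize l₁ l₂ l₃ l₄ l₅ = sum l₁ + sum l₂ + sum l₃ + sum l₄ + sum l₅

  totalSize-cong : ∀ {l₁ l₂ l₃ l₄ l₅ l₁′ l₂′ l₃′ l₄′ l₅′} → l₁ ≡ l₁′ → l₂ ≡ l₂′ → l₃ ≡ l₃′ → l₄ ≡ l₄′ → l₅ ≡ l₅′ →
                   totalSize l₁ l₂ l₃ l₄ l₅ ≡ totalSize l₁′ l₂′ l₃′ l₄′ l₅′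
  totalSize-cong refl refl refl refl refl = refl

  totalSize-weight : ∀ es xs m α β →
    totalSize (Halves.scale α) (Halves.scale β) (Halves.scale (fromMultiplicities xs)) (staircase m) (Thirds.scale (fromIndicator es))
    ≡ weight {n} (es , xs , m , α , β)
  totalSize-weight es xs m α β
    rewrite Halves.sum-scale α | Halves.sum-scale β | Halves.sum-scale (fromMultiplicities xs) | sum-fromMultiplicities xs
          | sum-staircase m | Thirds.sum-scale (fromIndicator es) | sum-fromIndicator es =
    rearrange (sum α) (sum β) (weightedSum id xs) (choose₂ (suc m)) (weightedSum bit es)
    where rearrange : ∀ a b x c e → a * 2 + b * 2 + x * 2 + c + e * 3 ≡ e * 3 + x * 2 + (2 * (a + b) + c)
          rearrange = solve-∀

  toCoordinates : V25 n → Coordinates n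
  toCoordinates v = indicator n (Thirds.unscale (λ₅ v)) , multiplicities n (Halves.unscale (λ₃ v)) ,
                    proj₁ (stair₄ v) , Halves.unscale (λ₁ v) , Halves.unscale (λ₂ v)

  fromCoordinates : ∀ c → AreValid n c → V25 n
  fromCoordinates (es , xs , m , α , β) (pα , pβ , w) = record
    { λ₁ = Halves.scale α ; λ₂ = Halves.scale β ; λ₃ = Halves.scale (fromMultiplicities xs)
    ; λ₄ = staircase m ; λ₅ = Thirds.scale (fromIndicator es)
    ; part₁ = Halves.scale-isPartition pα ; part₂ = Halves.scale-isPartition pβ
    ; part₃ = Halves.scale-isPartition (fromMultiplicities-isPartition xs)
    ; part₄ = staircase-isPartition m ; part₅ = Thirds.scale-isPartition (fromIndicator-isPartition es)
    ; total = trans (totalSize-weight es xs m α β) w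
    ; even₁ = Halves.scale-divisible α ; even₂ = Halves.scale-divisible β
    ; even₃ = Halves.scale-divisible (fromMultiplicities xs)
    ; stair₄ = m , refl
    ; distinct₅ = Thirds.scale-distinct (fromIndicator-distinct es) ; div3₅ = Thirds.scale-divisible (fromIndicator es)
    }

  module _ (v : V25 n) where
    private
      sums≤ : sum (λ₃ v) ≤ n × sum (λ₅ v) ≤ n
      sums≤ = ≤-trans (m≤n+m _ (sum (λ₁ v) + sum (λ₂ v)))
                (≤-trans (m≤m+n _ (sum (λ₄ v))) (≤-trans (m≤m+n _ (sum (λ₅ v))) (≤-reflexive (total v))))
            , ≤-trans (m≤n+m _ _) (≤-reflexive (total v))

    λ₁≡ : Halves.scale (Halves.unscale (λ₁ v)) ≡ λ₁ v
    λ₁≡ = Halves.scale-unscale (even₁ v)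

    λ₂≡ : Halves.scale (Halves.unscale (λ₂ v)) ≡ λ₂ v
    λ₂≡ = Halves.scale-unscale (even₂ v)

    λ₃≡ : Halves.scale (fromMultiplicities (multiplicities n (Halves.unscale (λ₃ v)))) ≡ λ₃ v
    λ₃≡ = trans (cong Halves.scale (fromMultiplicities-multiplicities n
                  (Halves.unscale-isPartition (even₃ v) (part₃ v))
                  (Halves.unscale-bounded (All≤-weaken (proj₁ sums≤) (parts≤sum (λ₃ v))))))
                (Halves.scale-unscale (even₃ v))

    λ₄≡ : staircase (proj₁ (stair₄ v)) ≡ λ₄ v
    λ₄≡ = sym (proj₂ (stair₄ v))

    λ₅≡ : Thirds.scale (fromIndicator (indicator n (Thirds.unscale (λ₅ v)))) ≡ λ₅ v
    λ₅≡ = trans (cong Thirds.scale (fromIndicator-indicator n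
                  (Thirds.unscale-distinct (div3₅ v) (distinct₅ v))
                  (Thirds.unscale-positive (div3₅ v) (proj₂ (part₅ v)))
                  (Thirds.unscale-bounded (All≤-weaken (proj₂ sums≤) (parts≤sum (λ₅ v))))))
                (Thirds.scale-unscale (div3₅ v))

    toCoordinates-valid : AreValid n (toCoordinates v)
    toCoordinates-valid = Halves.unscale-isPartition (even₁ v) (part₁ v) , Halves.unscale-isPartition (even₂ v) (part₂ v) ,
      trans (sym (totalSize-weight es xs m α β)) (trans (totalSize-cong λ₁≡ λ₂≡ λ₃≡ λ₄≡ λ₅≡) (total v))
      where
      es = indicator n (Thirds.unscale (λ₅ v))
      xs = multiplicities n (Halves.unscale (λ₃ v))
      m = proj₁ (stair₄ v)
      α = Halves.unscale (λ₁ v)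
      β = Halves.unscale (λ₂ v)

  toCoordinates-fromCoordinates : ∀ c (valid : AreValid n c) → toCoordinates (fromCoordinates c valid) ≡ c
  toCoordinates-fromCoordinates (es , xs , m , α , β) _
    rewrite Thirds.unscale-scale (fromIndicator es) | indicator-fromIndicator es
          | Halves.unscale-scale (fromMultiplicities xs) | multiplicities-fromMultiplicities xs
          | Halves.unscale-scale α | Halves.unscale-scale β = refl

  V25↔Coordinates : V25 n ↔ ValidCoordinates n
  V25↔Coordinates = mk↔ₛ′
    (λ v → toCoordinates v , toCoordinates-valid v)
    (λ (c , valid) → fromCoordinates c valid)
    (λ (c , valid) → Σ-≡-irrelevant {P = AreValid n} AreValid-irrelevant (toCoordinates-fromCoordinates c valid))
    (λ v → V25-≡ _ v (λ₁≡ v) (λ₂≡ v) (λ₃≡ v) (λ₄≡ v) (λ₅≡ v))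

lemma3p1 : (n : ℕ) → PD n ⤖ V25 n
lemma3p1 n = ↔⇒⤖ (↔-trans (DesignatedSide.PD↔Coordinates n) (↔-sym (QuintupleSide.V25↔Coordinates n)))
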